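{- Let $k,\ell$ be positive integers and let $T_{k,\ell}$ be the graph obtained from a cycle $C$ of length $3k$ with three vertices $v_1,v_2,v_3$ on $C$ pairwise at distance $k$ along $C$, by adding three vertex-disjoint paths $P_1,P_2,P_3$, each of length $\ell$, disjoint from $C$ except that one endpoint of $P_i$ is identified with $v_i$ for $i=1,2,3$. Then \[\rho(T_{k,\ell})=\max\left\{\left\lceil \frac{\ell}{2}+\frac{k-2}{4}\right\rceil,\ \left\lceil \frac{3k-2}{2}\right\rceil\right\}.\]
   Context: Patrol game with radius of capture $\rho\ge 0$ on a connected graph $G$: there is one cop and one robber. Before the game the cop fixes a walk in $G$ (his patrol: a sequence of vertices in which consecutive vertices are equal or adjacent), and the robber knows the entire patrol in advance, while the cop has no information about the robber. The cop starts at the first vertex of his patrol, then the robber chooses a starting vertex; afterwards the players alternate moves (cop first), the cop following his patrol and the robber moving to an adjacent vertex or staying put. The cop wins if at some moment the distance between the cop and the robber is at most $\rho$; otherwise the robber wins. $\rho(G)$ is the minimum $\rho\ge0$ for which the cop has a patrol capturing the robber regardless of the robber's play. Path length means number of edges. -}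

module Defs where

open import Data.Nat using (ℕ; zero; suc; _+_; _*_; _∸_; _≤_; _⊔_; ⌈_/2⌉; _/_)
open import Data.Fin using (Fin; toℕ)
open import Data.Sum using (_⊎_)
open import Data.Product using (_×_; Σ)
open import Relation.Binary.PropositionalEquality using (_≡_)
open import Relation.Nullary using (¬_)

record Graph : Set₁ where
  field
    V   : Set
    Adj : V → V → Set

module _ (G : Graph) where
  open Graph G

  Step : V → V → Set
  Step u v = u ≡ v ⊎ Adj u v

  -- Reach n u v : there is a (lazy) walk with n moves from u to v,
  -- i.e. dist(u,v) ≤ n.
  data Reach : ℕ → V → V → Set where
    here : ∀ {u} → Reach zero u u
    step : ∀ {n u w v} → Step u w → Reach n w v → Reach (suc n) u v

  DistLe : ℕ → V → V → Set
  DistLe n u v = Reach n u v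

  IsWalk : ℕ → (ℕ → V) → Set
  IsWalk N p = ∀ t → suc t ≤ N → Step (p t) (p (suc t))

  -- Patrol of length N given by p 0 … p N.  A robber moving along r
  -- (r 0 chosen after seeing p 0, then cop moves to p (t+1), robber to r (t+1))
  -- escapes with radius ρ if at every moment the distance exceeds ρ:
  --   after the robber's t-th placement/move:  (p t , r t)
  --   after the cop's (t+1)-th move:           (p (t+1) , r t)
  Escapes : ℕ → ℕ → (ℕ → V) → (ℕ → V) → Set
  Escapes ρ N p r =
    IsWalk N r ×
    ((∀ t → t ≤ N → ¬ DistLe ρ (p t) (r t)) ×
     (∀ t → suc t ≤ N → ¬ DistLe ρ (p (suc t)) (r t)))

  CopWins : ℕ → Set
  CopWins ρ = Σ ℕ λ N → Σ (ℕ → V) λ p →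
    IsWalk N p × (∀ r → ¬ Escapes ρ N p r)

  PatrolNumberIs : ℕ → Set
  PatrolNumberIs m = CopWins m × (∀ ρ → CopWins ρ → m ≤ ρ)

-- Cycle vertices: inj₁ a, a ∈ Fin (3k), cycle a ~ a+1 (mod 3k);
-- v_i = cycle vertex i*k (i = 0,1,2), pairwise at distance k along C.
-- Path vertices: inj₂ (i , j), j ∈ Fin ℓ, the vertex of P_i at distance j+1 from v_i.

TV : ℕ → ℕ → Set
TV k l = Fin (3 * k) ⊎ (Fin 3 × Fin l)

data TEdge (k l : ℕ) : TV k l → TV k l → Set where
  cyc      : (a b : Fin (3 * k)) → suc (toℕ a) ≡ toℕ b →
             TEdge k l (_⊎_.inj₁ a) (_⊎_.inj₁ b)
  cycWrap  : (a b : Fin (3 * k)) → suc (toℕ a) ≡ 3 * k → toℕ b ≡ 0 →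
             TEdge k l (_⊎_.inj₁ a) (_⊎_.inj₁ b)
  attach   : (a : Fin (3 * k)) (i : Fin 3) (j : Fin l) →
             toℕ a ≡ toℕ i * k → toℕ j ≡ 0 →
             TEdge k l (_⊎_.inj₁ a) (_⊎_.inj₂ (i Data.Product., j))
  pathStep : (i : Fin 3) (j j' : Fin l) → suc (toℕ j) ≡ toℕ j' →
             TEdge k l (_⊎_.inj₂ (i Data.Product., j)) (_⊎_.inj₂ (i Data.Product., j'))

T : ℕ → ℕ → Graph
T k l = record { V = TV k l ; Adj = λ u v → TEdge k l u v ⊎ TEdge k l v u }

⌈_/4⌉ : ℕ → ℕ
⌈ n /4⌉ = (n + 3) / 4

{-# OPTIONS --safe #-}
module Submission where

-- Upper bound (3k ≤ 2ρ + 2 and 2ℓ + k ≤ 4ρ + 2, with d = ℓ ∸ ρ): the cop descends P₁ from depth d, walks the arc v₁v₂,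
-- climbs P₂ to depth d and descends again, walks the arc v₂v₃ and climbs P₃ to depth d. On a cycle of length at most
-- 2ρ + 2 no vertex is far from two adjacent vertices, so the robber cannot stay on an arc the cop walks; a robber on a
-- leg the cop climbs is pushed past its end because ℓ ≤ d + ρ; and 2d + k ≤ 2ρ + 2 keeps the robber away from P₁ while
-- the cop is on P₂.
-- Lower bounds: if 2ρ + 3 ≤ 3k the robber stays on the cycle at two adjacent vertices opposite the cop's projection.
-- If 4ρ + 3 ≤ 2ℓ + k, let θ = ρ + 1 − k ≥ 1. While the cop is within depth θ on two legs, a robber waits just out of
-- reach on each of them; when the cop goes deeper than θ into one of these legs, the robber of the other one runs along
-- the cycle to the third leg, and the legs are long enough for him to get there before the cop can come back.

open import Defs
open import Data.Nat using (ℕ; zero; suc; _+_; _*_; _∸_; _≤_; _<_; _≤?_; _<?_; z≤n; s≤s; _⊓_; _⊔_; ∣_-_∣; pred; ⌈_/2⌉; ⌊_/2⌋; _%_)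
open import Data.Nat.Properties
open import Data.Nat.DivMod using (m≡m%n+[m/n]*n; m%n<n; m<n*o⇒m/o<n)
open import Function.Bundles using (_⇔_; mk⇔; Equivalence)
open import Data.Fin using (Fin; toℕ) renaming (zero to fz; suc to fs)
open import Data.Fin.Properties using (toℕ<n; toℕ-injective)
open import Data.Sum using (_⊎_; inj₁; inj₂)
open import Data.Product using (Σ; _×_; _,_; proj₁; proj₂; swap)
open import Data.Empty using (⊥; ⊥-elim)
open import Relation.Nullary using (¬_; Dec; yes; no)
open import Relation.Binary.PropositionalEquality using (_≡_; _≢_; ≢-sym; refl; sym; trans; cong; subst; subst₂; module ≡-Reasoning)
open import Data.Nat.Tactic.RingSolver
open import Data.List using (_∷_; [])

-- Linear inequalities are proved by adding up the hypotheses and closing the resulting equation with the ring solver.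
≤-balance : ∀ a b c {X Y} → X ≤ Y → b + X ≡ a + c + Y → a ≤ b
≤-balance a b c {X} {Y} X≤Y eq =
  +-cancelʳ-≤ X a b (≤-trans (+-monoʳ-≤ a X≤Y) (≤-trans (+-monoˡ-≤ Y (m≤m+n a c)) (≤-reflexive (sym eq))))

3k≤2ρ+2⇒k≤ρ : ∀ K ρ → 3 * K ≤ 2 * ρ + 2 → K ≤ ρ
3k≤2ρ+2⇒k≤ρ K ρ h2 with K ≤? ρ
... | yes q = q
... | no q = ⊥-elim (1+n≰n (≤-balance 1 0 ρ (+-mono-≤ (*-monoʳ-≤ 3 (≰⇒> q)) h2) (eq K ρ)))
  where
  eq : ∀ K ρ → 0 + (3 * suc ρ + 3 * K) ≡ 1 + ρ + (3 * K + (2 * ρ + 2))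
  eq K ρ = solve (K ∷ ρ ∷ [])

m∸n≤o⇒m≤o+n : ∀ m n o → m ∸ n ≤ o → m ≤ o + n
m∸n≤o⇒m≤o+n m n o h = ≤-trans (m≤n+m∸n m n) (≤-trans (+-monoʳ-≤ n h) (≤-reflexive (+-comm n o)))

clamp : (m d : ℕ) → Fin (suc m)
clamp m zero = fz
clamp zero (suc d) = fz
clamp (suc m) (suc d) = fs (clamp m d)

toℕ-clamp : ∀ m d → d ≤ m → toℕ (clamp m d) ≡ d
toℕ-clamp m zero _ = refl
toℕ-clamp (suc m) (suc d) (s≤s h) = cong suc (toℕ-clamp m d h)

clamp-toℕ : ∀ m (j : Fin (suc m)) → clamp m (toℕ j) ≡ j
clamp-toℕ m fz = refl
clamp-toℕ (suc m) (fs j) = cong fs (clamp-toℕ m j)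

∸-sucʳ : ∀ n x → suc x ≤ n → n ∸ x ≡ suc (n ∸ suc x)
∸-sucʳ (suc n) zero _ = refl
∸-sucʳ (suc n) (suc x) (s≤s h) = ∸-sucʳ n x h

window-too-narrow : ∀ ρ x n → n ≤ 2 * ρ + 2 → ρ + 1 ≤ x → suc x + (ρ + 1) ≤ n → ⊥
window-too-narrow ρ x n hn h1 h2 = 1+n≰n (≤-balance 1 0 0 (+-mono-≤ (+-mono-≤ h1 h2) hn) (eq ρ x n))
  where
  eq : ∀ ρ x n → 0 + (ρ + 1 + (suc x + (ρ + 1)) + n) ≡ 1 + 0 + (x + n + (2 * ρ + 2))
  eq ρ x n = solve (ρ ∷ x ∷ n ∷ [])

k<3k : ∀ k' → suc (suc k') ≤ 3 * suc k'
k<3k k' = ≤-balance (suc (suc k')) (3 * suc k') (2 * k' + 1) {0} {0} ≤-refl (solve (k' ∷ []))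

2k<3k : ∀ k' → suc (2 * suc k') ≤ 3 * suc k'
2k<3k k' = ≤-balance (suc (2 * suc k')) (3 * suc k') k' {0} {0} ≤-refl (solve (k' ∷ []))

k≤2k : ∀ k' → suc k' ≤ 2 * suc k'
k≤2k k' = ≤-balance (suc k') (2 * suc k') (k' + 1) {0} {0} ≤-refl (solve (k' ∷ []))

3k≡k+2k : ∀ k' → 3 * suc k' ≡ suc k' + 2 * suc k'
3k≡k+2k k' = solve (k' ∷ [])

3k≡2k+k : ∀ k' → 3 * suc k' ≡ 2 * suc k' + suc k'
3k≡2k+k k' = solve (k' ∷ [])

3k∸k≡2k : ∀ k' → 3 * suc k' ∸ suc k' ≡ 2 * suc k'
3k∸k≡2k k' = trans (cong (_∸ suc k') (3k≡k+2k k')) (m+n∸m≡n (suc k') (2 * suc k'))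

3k∸2k≡k : ∀ k' → 3 * suc k' ∸ 2 * suc k' ≡ suc k'
3k∸2k≡k k' = trans (cong (_∸ 2 * suc k') (3k≡2k+k k')) (m+n∸m≡n (2 * suc k') (suc k'))

k+s<3k : ∀ k' s → s ≤ suc k' → suc (suc k' + s) ≤ 3 * suc k'
k+s<3k k' s h = ≤-balance (suc (suc k' + s)) (3 * suc k') k' h (e k' s)
  where
  e : ∀ k' s → 3 * suc k' + s ≡ suc (suc k' + s) + k' + suc k'
  e k' s = solve (k' ∷ s ∷ [])

2k+s<3k : ∀ k' s → suc s ≤ suc k' → suc (2 * suc k' + s) ≤ 3 * suc k'
2k+s<3k k' s h = ≤-balance (suc (2 * suc k' + s)) (3 * suc k') 0 h (e k' s)
  where
  e : ∀ k' s → 3 * suc k' + suc s ≡ suc (2 * suc k' + s) + 0 + suc k'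
  e k' s = solve (k' ∷ s ∷ [])

s+r≡k⇒2k≡s+[r+k] : ∀ K s r → s + r ≡ K → 2 * K ≡ s + (r + K)
s+r≡k⇒2k≡s+[r+k] K s r e rewrite sym e = solve (s ∷ r ∷ [])

s+r≡k⇒2k≡r+[k+s] : ∀ K s r → s + r ≡ K → 2 * K ≡ r + (K + s)
s+r≡k⇒2k≡r+[k+s] K s r e rewrite sym e = solve (s ∷ r ∷ [])

s+r≡k⇒2k≡s+[k+r] : ∀ K s r → s + r ≡ K → 2 * K ≡ s + (K + r)
s+r≡k⇒2k≡s+[k+r] K s r e rewrite sym e = solve (s ∷ r ∷ [])

2k+s≡k+0+[k+s] : ∀ K s → 2 * K + s ≡ (K + 0) + (K + s)
2k+s≡k+0+[k+s] K s = solve (K ∷ s ∷ [])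

s+r≡k'⇒k'+2k≡s+[r+2k] : ∀ k' s r → s + r ≡ k' → k' + 2 * suc k' ≡ s + (r + 2 * suc k')
s+r≡k'⇒k'+2k≡s+[r+2k] k' s r e rewrite sym e = solve (s ∷ r ∷ [])

r+2k≡k+0+[r+k] : ∀ K r → r + 2 * K ≡ (K + 0) + (r + K)
r+2k≡k+0+[r+k] K r = solve (K ∷ r ∷ [])

last-step≡ : ∀ k' s → s < suc k' → ¬ (suc s < suc k') → 2 * suc k' + s ≡ k' + 2 * suc k'
last-step≡ k' s h1 h2 rewrite suc-injective (≤-antisym h1 (≤-pred (≰⇒> h2))) = +-comm (2 * suc k') k'

r≤k⇒r+k≤2k : ∀ K r → r ≤ K → r + K ≤ 2 * K
r≤k⇒r+k≤2k K r h = ≤-trans (+-monoˡ-≤ K h) (≤-reflexive (e K))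
  where
  e : ∀ K → K + K ≡ 2 * K
  e K = solve (K ∷ [])

r≤k⇒k+r≤2k : ∀ K r → r ≤ K → K + r ≤ 2 * K
r≤k⇒k+r≤2k K r h = subst (_≤ 2 * K) (+-comm r K) (r≤k⇒r+k≤2k K r h)

∣-∣≤ : ∀ a b ρ → a ≤ b + ρ → b ≤ a + ρ → ∣ a - b ∣ ≤ ρ
∣-∣≤ a b ρ h1 h2 with ≤-total a b
... | inj₁ h = subst (_≤ ρ) (sym (m≤n⇒∣m-n∣≡n∸m h)) (m≤n+o⇒m∸n≤o b a h2)
... | inj₂ h = subst (_≤ ρ) (sym (m≤n⇒∣n-m∣≡n∸m h)) (m≤n+o⇒m∸n≤o a b h1)

module SymmetricGraph (G : Graph) (Adj-sym : ∀ {u v} → Graph.Adj G u v → Graph.Adj G v u) where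
  open Graph G

  Step-sym : ∀ {u v} → Step G u v → Step G v u
  Step-sym (inj₁ refl) = inj₁ refl
  Step-sym (inj₂ a) = inj₂ (Adj-sym a)

  Reach-snoc : ∀ {n u w v} → Reach G n u w → Step G w v → Reach G (suc n) u v
  Reach-snoc here s = step s here
  Reach-snoc (step s' r) s = step s' (Reach-snoc r s)

  Reach-sym : ∀ {n u v} → Reach G n u v → Reach G n v u
  Reach-sym here = here
  Reach-sym (step s r) = Reach-snoc (Reach-sym r) (Step-sym s)

  Reach-trans : ∀ {m n u w v} → Reach G m u w → Reach G n w v → Reach G (m + n) u v
  Reach-trans here r = r
  Reach-trans (step s r₁) r = step s (Reach-trans r₁ r)

  Reach-pad : ∀ {m} d {u v} → Reach G m u v → Reach G (d + m) u v
  Reach-pad zero r = r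
  Reach-pad (suc d) r = step (inj₁ refl) (Reach-pad d r)

  Reach-mono : ∀ {m n u v} → m ≤ n → Reach G m u v → Reach G n u v
  Reach-mono {m} {n} m≤n r = subst (λ x → Reach G x _ _) (m∸n+n≡m m≤n) (Reach-pad (n ∸ m) r)

module RobberGame (G : Graph) (ρ : ℕ) where
  open Graph G

  Far : V → V → Set
  Far c u = ¬ Reach G ρ c u

  MovesInto : V → (V → Set) → (V → Set) → Set
  MovesInto c P P' = ∀ u' → P' u' → Σ V λ u → P u × Far c u × Step G u u' × Far c u'

  MovesInto-map : ∀ {c} {P Q P' : V → Set} → (∀ {u} → P u → Q u) → MovesInto c P P' → MovesInto c Q P'
  MovesInto-map g mv u' h with mv u' h
  ... | u , p , far , st , far' = u , g p , far , st , far'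

  -- The robber knows the patrol in advance, so it suffices to keep a nonempty set Hides c st of safe positions,
  -- each reachable by a safe move from the previous set.
  record RobberStrategy : Set₁ where
    field
      State      : Set
      Valid      : V → State → Set
      Hides      : V → State → V → Set
      start      : ∀ c → Σ State (Valid c)
      hides-far  : ∀ c st → Valid c st → ∀ u → Hides c st u → Far c u
      hides-some : ∀ c st → Valid c st → Σ V (Hides c st)
      respond    : ∀ c c' → Step G c c' → ∀ st → Valid c st →
                   Σ State λ st' → Valid c' st' × MovesInto c' (Hides c st) (Hides c' st')

  module Survival (p : ℕ → V) where

    data Survives : ℕ → V → Set where
      initial : ∀ {u} → Far (p 0) u → Survives 0 u
      move  : ∀ {t u w} → Survives t u → Far (p (suc t)) u → Step G u w → Far (p (suc t)) w → Survives (suc t) w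

    route : ∀ {t u} → Survives t u → ℕ → V
    route {u = u} (initial _) s = u
    route {suc t} {w} (move a _ _ _) s with s ≤? t
    ... | yes _ = route a s
    ... | no _ = w

    route-end : ∀ {t u} (a : Survives t u) → route a t ≡ u
    route-end (initial _) = refl
    route-end {suc t} (move a _ _ _) with suc t ≤? t
    ... | yes q = ⊥-elim (<-irrefl refl q)
    ... | no _ = refl

    route-far : ∀ {t u} (a : Survives t u) → ∀ s → s ≤ t → Far (p s) (route a s)
    route-far (initial far) zero z≤n = far
    route-far {suc t} (move a f1 st f2) s s≤ with s ≤? t
    ... | yes q = route-far a s q
    ... | no q = subst (λ x → Far (p x) _) (sym (≤-antisym s≤ (≰⇒> q))) f2

    route-far-next : ∀ {t u} (a : Survives t u) → ∀ s → suc s ≤ t → Far (p (suc s)) (route a s)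
    route-far-next {suc t} (move a f1 st f2) s s< with s ≤? t
    ... | no q = ⊥-elim (q (≤-pred s<))
    ... | yes q with suc s ≤? t
    ...   | yes q' = route-far-next a s q'
    ...   | no q' = subst (λ x → Far (p (suc x)) (route a x)) (sym s≡t) (subst (Far (p (suc t))) (sym (route-end a)) f1)
      where
      s≡t : s ≡ t
      s≡t = ≤-antisym q (≤-pred (≰⇒> q'))

    route-walk : ∀ {t u} (a : Survives t u) → ∀ s → suc s ≤ t → Step G (route a s) (route a (suc s))
    route-walk {suc t} (move a f1 st f2) s s< with s ≤? t | suc s ≤? t
    ... | no q | _ = ⊥-elim (q (≤-pred s<))
    ... | yes q | yes q' = route-walk a s q'
    ... | yes q | no q' = subst (λ x → Step G (route a x) _) (sym s≡t) (subst (λ x → Step G x _) (sym (route-end a)) st)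
      where
      s≡t : s ≡ t
      s≡t = ≤-antisym q (≤-pred (≰⇒> q'))

    survivor-escapes : ∀ {N u} (a : Survives N u) → Escapes G ρ N p (route a)
    survivor-escapes a = (λ s s< → route-walk a s s<) , (λ s s≤ → route-far a s s≤) , (λ s s< → route-far-next a s s<)

  strategy⇒¬CopWins : RobberStrategy → ¬ CopWins G ρ
  strategy⇒¬CopWins σ (N , p , p-walk , catches) = catches _ (survivor-escapes (proj₂ survivor))
    where
    open RobberStrategy σ
    open Survival p
    invariant : ∀ t → t ≤ N → Σ State λ st → Valid (p t) st × (∀ u → Hides (p t) st u → Survives t u)
    invariant zero _ with start (p 0)
    ... | st , v = st , v , λ u h → initial (hides-far (p 0) st v u h)
    invariant (suc t) t< with invariant t (≤-trans (n≤1+n t) t<)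
    ... | st , v , surv with respond (p t) (p (suc t)) (p-walk t t<) st v
    ...   | st' , v' , mv = st' , v' , λ u' h' → let (u , h , far , s , far') = mv u' h' in move (surv u h) far s far'
    survivor : Σ V (Survives N)
    survivor with invariant N ≤-refl
    ... | st , v , surv = let (u , h) = hides-some (p N) st v in u , surv u h

module Concatenation (G : Graph) (ρ : ℕ) where
  open Graph G

  append : ℕ → (ℕ → V) → (ℕ → V) → ℕ → V
  append L q q' t with t ≤? L
  ... | yes _ = q t
  ... | no _ = q' (t ∸ L)

  append-left : ∀ L q q' t → t ≤ L → append L q q' t ≡ q t
  append-left L q q' t h with t ≤? L
  ... | yes _ = refl
  ... | no x = ⊥-elim (x h)

  append-right : ∀ L q q' s → q L ≡ q' 0 → append L q q' (L + s) ≡ q' s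
  append-right L q q' zero e = trans (append-left L q q' (L + 0) (≤-reflexive (+-identityʳ L))) (trans (cong q (+-identityʳ L)) e)
  append-right L q q' (suc s) e with L + suc s ≤? L
  ... | yes x = ⊥-elim (1+n≰n (≤-trans (≤-trans (s≤s (m≤m+n L s)) (≤-reflexive (sym (+-suc L s)))) x))
  ... | no _ = cong q' (m+n∸m≡n L (suc s))

  append-walk : ∀ L L' q q' → IsWalk G L q → IsWalk G L' q' → q L ≡ q' 0 → IsWalk G (L + L') (append L q q')
  append-walk L L' q q' w w' e t h = step-at (suc t ≤? L)
    where
    step-at : Dec (suc t ≤ L) → Step G (append L q q' t) (append L q q' (suc t))
    step-at (yes t<L) = subst₂ (Step G) (sym (append-left L q q' t (≤-trans (n≤1+n t) t<L))) (sym (append-left L q q' (suc t) t<L)) (w t t<L)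
    step-at (no t≮L) with m≤n⇒∃[o]m+o≡n (≤-pred (≰⇒> t≮L))
    ... | j , refl = subst₂ (Step G) (sym (append-right L q q' j e))
                       (sym (trans (cong (append L q q') (sym (+-suc L j))) (append-right L q q' (suc j) e)))
                       (w' j (+-cancelˡ-≤ L (suc j) L' (subst (_≤ L + L') (sym (+-suc L j)) h)))

  later : ℕ → (ℕ → V) → ℕ → V
  later L r s = r (L + s)

  append-escapes : ∀ L L' q q' r → q L ≡ q' 0 → Escapes G ρ (L + L') (append L q q') r →
                   Escapes G ρ L q r × Escapes G ρ L' q' (later L r)
  append-escapes L L' q q' r e (w , f1 , f2) =
    ((λ t h → w t (≤-trans h (m≤m+n L L'))) ,
     (λ t h → subst (λ z → ¬ Reach G ρ z (r t)) (append-left L q q' t h) (f1 t (≤-trans h (m≤m+n L L')))) ,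
     (λ t h → subst (λ z → ¬ Reach G ρ z (r t)) (append-left L q q' (suc t) h) (f2 t (≤-trans h (m≤m+n L L'))))) ,
    ((λ t h → subst (λ z → Step G (r (L + t)) (r z)) (sym (+-suc L t)) (w (L + t) (subst (_≤ L + L') (+-suc L t) (+-monoʳ-≤ L h)))) ,
     (λ t h → subst (λ z → ¬ Reach G ρ z (r (L + t))) (append-right L q q' t e) (f1 (L + t) (+-monoʳ-≤ L h))) ,
     (λ t h → subst (λ z → ¬ Reach G ρ z (r (L + t))) (trans (cong (append L q q') (sym (+-suc L t))) (append-right L q q' (suc t) e)) (f2 (L + t) (subst (_≤ L + L') (+-suc L t) (+-monoʳ-≤ L h)))))

module CyclicDistance (m₀ : ℕ) where
  n : ℕ
  n = suc m₀

  cnorm : ℕ → ℕ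
  cnorm x = x ⊓ (n ∸ x)

  cnorm-suc : ∀ x → suc x ≤ n → (cnorm (suc x) ≤ suc (cnorm x)) × (cnorm x ≤ suc (cnorm (suc x)))
  cnorm-suc x h rewrite ∸-sucʳ n x h =
    ⊓-monoʳ-≤ (suc x) (≤-trans (n≤1+n _) (n≤1+n _)) ,
    ⊓-mono-≤ (≤-trans (n≤1+n x) (n≤1+n _)) ≤-refl

  cnorm-mirror : ∀ x → x ≤ n → cnorm (n ∸ x) ≡ cnorm x
  cnorm-mirror x h rewrite m∸[m∸n]≡n h = ⊓-comm (n ∸ x) x

  cdist : ℕ → ℕ → ℕ
  cdist a b = cnorm ∣ a - b ∣

  ∣-∣-suc : ∀ a c → (∣ suc a - c ∣ ≡ suc ∣ a - c ∣) ⊎ (∣ a - c ∣ ≡ suc ∣ suc a - c ∣)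
  ∣-∣-suc zero zero = inj₁ refl
  ∣-∣-suc zero (suc c) = inj₂ refl
  ∣-∣-suc (suc a) zero = inj₁ refl
  ∣-∣-suc (suc a) (suc c) = ∣-∣-suc a c

  ∣-∣< : ∀ a c → a < n → c < n → ∣ a - c ∣ < n
  ∣-∣< a c ha hc = ≤-<-trans (∣m-n∣≤m⊔n a c) (⊔-lub ha hc)

  cdist-suc : ∀ a c → suc a < n → c < n → (cdist (suc a) c ≤ suc (cdist a c)) × (cdist a c ≤ suc (cdist (suc a) c))
  cdist-suc a c ha hc with ∣-∣-suc a c
  ... | inj₁ e = subst (λ z → (cnorm z ≤ suc (cnorm ∣ a - c ∣)) × (cnorm ∣ a - c ∣ ≤ suc (cnorm z))) (sym e) (cnorm-suc ∣ a - c ∣ (<⇒≤ (subst (_< n) e (∣-∣< (suc a) c ha hc))))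
  ... | inj₂ e = subst (λ z → (cnorm ∣ suc a - c ∣ ≤ suc (cnorm z)) × (cnorm z ≤ suc (cnorm ∣ suc a - c ∣))) (sym e) (proj₂ fl , proj₁ fl)
    where
    fl = cnorm-suc ∣ suc a - c ∣ (<⇒≤ (subst (_< n) e (∣-∣< a c (≤-trans (n≤1+n _) ha) hc)))

  cdist-wrap : ∀ c → c < n → (cdist 0 c ≤ suc (cdist m₀ c)) × (cdist m₀ c ≤ suc (cdist 0 c))
  cdist-wrap c hc = subst (λ z → cnorm c ≤ suc z) (sym eq) (proj₂ (cnorm-suc c hc)) , subst (λ z → z ≤ suc (cnorm c)) (sym eq) (proj₁ (cnorm-suc c hc))
    where
    eq : cdist m₀ c ≡ cnorm (suc c)
    eq = begin
      cnorm ∣ m₀ - c ∣ ≡⟨ cong cnorm (m≤n⇒∣n-m∣≡n∸m (≤-pred hc)) ⟩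
      cnorm (n ∸ suc c) ≡⟨ cnorm-mirror (suc c) hc ⟩
      cnorm (suc c) ∎
      where open ≡-Reasoning

  cdist-self : ∀ a → cdist a a ≡ 0
  cdist-self a rewrite ∣n-n∣≡0 a = refl

  cdist-sym : ∀ a b → cdist a b ≡ cdist b a
  cdist-sym a b = cong cnorm (∣-∣-comm a b)

  ≤-cdist : ∀ a b m → m ≤ ∣ a - b ∣ → ∣ a - b ∣ + m ≤ n → m ≤ cdist a b
  ≤-cdist a b m h1 h2 = ⊓-glb h1 (m+n≤o⇒m≤o∸n m (subst (_≤ n) (+-comm ∣ a - b ∣ m) h2))

  cdist≤∣-∣ : ∀ a b → cdist a b ≤ ∣ a - b ∣
  cdist≤∣-∣ a b = m⊓n≤m _ _

  ≤cnorm⇒ : ∀ x m → m ≤ x ⊓ (n ∸ x) → x < n → (m ≤ x) × (x + m ≤ n)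
  ≤cnorm⇒ x m h hx = ≤-trans h (m⊓n≤m x _) , subst (x + m ≤_) (m+[n∸m]≡n (<⇒≤ hx)) (+-monoʳ-≤ x (≤-trans h (m⊓n≤n x _)))

  no-common-antipode : ∀ ρ → n ≤ 2 * ρ + 2 → ∀ a b → a < n → suc b < n → ρ + 1 ≤ cdist a b → ρ + 1 ≤ cdist a (suc b) → ⊥
  no-common-antipode ρ hn a b ha hb h1 h2 with ≤cnorm⇒ ∣ a - b ∣ (ρ + 1) h1 (∣-∣< a b ha (≤-trans (n≤1+n _) hb)) | ≤cnorm⇒ ∣ a - suc b ∣ (ρ + 1) h2 (∣-∣< a (suc b) ha hb)
  ... | x1 , y1 | x2 , y2 with ∣-∣-suc b a
  ... | inj₁ e = window-too-narrow ρ ∣ a - b ∣ n hn x1 (subst (λ z → z + (ρ + 1) ≤ n) (trans (∣-∣-comm a (suc b)) (trans e (cong suc (∣-∣-comm b a)))) y2)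
  ... | inj₂ e = window-too-narrow ρ ∣ a - suc b ∣ n hn x2 (subst (λ z → z + (ρ + 1) ≤ n) (trans (∣-∣-comm a b) (trans e (cong suc (∣-∣-comm (suc b) a)))) y1)

  nextPos : ℕ → ℕ
  nextPos a with suc a <? n
  ... | yes _ = suc a
  ... | no _ = 0

  nextPos<n : ∀ a → nextPos a < n
  nextPos<n a with suc a <? n
  ... | yes h = h
  ... | no _ = s≤s z≤n

  nextPos-suc : ∀ a → suc a < n → nextPos a ≡ suc a
  nextPos-suc a h with suc a <? n
  ... | yes _ = refl
  ... | no q = ⊥-elim (q h)

  nextPos-wrap : ∀ a → a < n → ¬ (suc a < n) → a ≡ m₀
  nextPos-wrap a h q = ≤-antisym (≤-pred h) (≤-pred (≰⇒> (λ z → q (s≤s z))))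

  nextPos-last : nextPos m₀ ≡ 0
  nextPos-last with suc m₀ <? n
  ... | yes h = ⊥-elim (<-irrefl refl h)
  ... | no _ = refl

  cdist-nextPos : ∀ a b → a < n → b < n → cdist (nextPos a) (nextPos b) ≡ cdist a b
  cdist-nextPos a b ha hb with suc a <? n | suc b <? n
  ... | yes _ | yes _ = refl
  ... | no qa | no qb rewrite nextPos-wrap a ha qa | nextPos-wrap b hb qb = trans (cdist-self 0) (sym (cdist-self m₀))
  ... | no qa | yes hb' rewrite nextPos-wrap a ha qa = sym (trans (cong cnorm (m≤n⇒∣n-m∣≡n∸m (≤-trans (n≤1+n b) (≤-pred hb')))) (trans (cong cnorm e) (cnorm-mirror (suc b) (<⇒≤ hb'))))
    where
    e : m₀ ∸ b ≡ n ∸ suc b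
    e = refl
  ... | yes ha' | no qb rewrite nextPos-wrap b hb qb = sym (trans (cong cnorm (trans (∣-∣-comm a m₀) (m≤n⇒∣n-m∣≡n∸m (≤-trans (n≤1+n a) (≤-pred ha'))))) (trans (cong cnorm e) (cnorm-mirror (suc a) (<⇒≤ ha'))))
    where
    e : m₀ ∸ a ≡ n ∸ suc a
    e = refl

  prevPos : ℕ → ℕ
  prevPos zero = m₀
  prevPos (suc a) = a

  prevPos<n : ∀ a → a < n → prevPos a < n
  prevPos<n zero _ = ≤-refl
  prevPos<n (suc a) h = ≤-trans (n≤1+n _) h

  nextPos-prevPos : ∀ a → a < n → nextPos (prevPos a) ≡ a
  nextPos-prevPos zero _ = nextPos-last
  nextPos-prevPos (suc a) h = nextPos-suc a h

  rotate : ℕ → ℕ → ℕ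
  rotate zero a = a
  rotate (suc j) a = nextPos (rotate j a)

  rotate<n : ∀ j a → a < n → rotate j a < n
  rotate<n zero a h = h
  rotate<n (suc j) a h = nextPos<n _

  cdist-rotate : ∀ j a b → a < n → b < n → cdist (rotate j a) (rotate j b) ≡ cdist a b
  cdist-rotate zero a b ha hb = refl
  cdist-rotate (suc j) a b ha hb = trans (cdist-nextPos _ _ (rotate<n j a ha) (rotate<n j b hb)) (cdist-rotate j a b ha hb)

  rotate-nextPos : ∀ j a → rotate j (nextPos a) ≡ nextPos (rotate j a)
  rotate-nextPos zero a = refl
  rotate-nextPos (suc j) a = cong nextPos (rotate-nextPos j a)

  rotate-0 : ∀ a → a < n → rotate a 0 ≡ a
  rotate-0 zero h = refl
  rotate-0 (suc a) h = trans (cong nextPos (rotate-0 a (≤-trans (n≤1+n _) h))) (nextPos-suc a h)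

data Dir : Set where
  fwd bwd : Dir

flip : Dir → Dir
flip fwd = bwd
flip bwd = fwd

ahead : Fin 3 → Dir → Fin 3
ahead fz fwd = fs fz
ahead (fs fz) fwd = fs (fs fz)
ahead (fs (fs fz)) fwd = fz
ahead fz bwd = fs (fs fz)
ahead (fs fz) bwd = fz
ahead (fs (fs fz)) bwd = fs fz

behind : Fin 3 → Dir → Fin 3
behind y d = ahead y (flip d)

behind-ahead : ∀ y d → behind (ahead y d) d ≡ y
behind-ahead fz fwd = refl
behind-ahead (fs fz) fwd = refl
behind-ahead (fs (fs fz)) fwd = refl
behind-ahead fz bwd = refl
behind-ahead (fs fz) bwd = refl
behind-ahead (fs (fs fz)) bwd = refl

flip-flip : ∀ d → flip (flip d) ≡ d
flip-flip fwd = refl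
flip-flip bwd = refl

ahead≢ : ∀ y d → ahead y d ≢ y
ahead≢ fz fwd ()
ahead≢ (fs fz) fwd ()
ahead≢ (fs (fs fz)) fwd ()
ahead≢ fz bwd ()
ahead≢ (fs fz) bwd ()
ahead≢ (fs (fs fz)) bwd ()

behind≢ : ∀ y d → behind y d ≢ y
behind≢ y d = ahead≢ y (flip d)

ahead≢behind : ∀ y d → ahead y d ≢ behind y d
ahead≢behind fz fwd ()
ahead≢behind (fs fz) fwd ()
ahead≢behind (fs (fs fz)) fwd ()
ahead≢behind fz bwd ()
ahead≢behind (fs fz) bwd ()
ahead≢behind (fs (fs fz)) bwd ()

module Tkl (k' l' : ℕ) where
  k : ℕ
  k = suc k'
  l : ℕ
  l = suc l'
  m₀ : ℕ
  m₀ = k' + 2 * k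

  open CyclicDistance m₀ public

  V : Set
  V = TV k l
  G : Graph
  G = T k l

  adjSym : ∀ {u v} → Graph.Adj G u v → Graph.Adj G v u
  adjSym (inj₁ e) = inj₂ e
  adjSym (inj₂ e) = inj₁ e

  open SymmetricGraph G adjSym public

  Stp : V → V → Set
  Stp = Step G

  cycV : ℕ → V
  cycV a = inj₁ (clamp m₀ a)

  hub<n : ∀ (y : Fin 3) → toℕ y * k < n
  hub<n fz = s≤s z≤n
  hub<n (fs fz) = subst (_< n) (sym (*-identityˡ k)) (k<3k k')
  hub<n (fs (fs fz)) = 2k<3k k'

  hub : Fin 3 → V
  hub y = cycV (toℕ y * k)

  leg : Fin 3 → ℕ → V
  leg y zero = hub y
  leg y (suc d) = inj₂ (y , clamp l' d)

  toℕ-cycV : ∀ a → a < n → toℕ (clamp m₀ a) ≡ a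
  toℕ-cycV a h = toℕ-clamp m₀ a (≤-pred h)

  cycV-step : ∀ a → suc a < n → Stp (cycV a) (cycV (suc a))
  cycV-step a h = inj₂ (inj₁ (cyc _ _ (trans (cong suc (toℕ-cycV a (≤-trans (n≤1+n _) h))) (sym (toℕ-cycV (suc a) h)))))

  cycV-wrap : Stp (cycV m₀) (cycV 0)
  cycV-wrap = inj₂ (inj₁ (cycWrap _ _ (cong suc (toℕ-cycV m₀ ≤-refl)) refl))

  leg-step : ∀ y d → suc d ≤ l → Stp (leg y d) (leg y (suc d))
  leg-step y zero h = inj₂ (inj₁ (attach _ y _ (toℕ-cycV _ (hub<n y)) refl))
  leg-step y (suc d) h = inj₂ (inj₁ (pathStep y _ _ (trans (cong suc (toℕ-clamp l' d (≤-trans (n≤1+n d) (≤-pred h)))) (sym (toℕ-clamp l' (suc d) (≤-pred h))))))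

  cdist-cycEdge : ∀ {c} {a b : Fin n} → c < n → TEdge k l (inj₁ a) (inj₁ b) →
                  (cdist (toℕ a) c ≤ suc (cdist (toℕ b) c)) × (cdist (toℕ b) c ≤ suc (cdist (toℕ a) c))
  cdist-cycEdge {c} h (cyc a b e) rewrite sym e = swap (cdist-suc (toℕ a) c (subst (_< n) (sym e) (toℕ<n b)) h)
  cdist-cycEdge {c} h (cycWrap a b e1 e2) rewrite suc-injective e1 | e2 = swap (cdist-wrap c h)

  ifSame : Fin 3 → Fin 3 → ℕ → ℕ → ℕ
  ifSame fz fz a b = a
  ifSame fz (fs fz) a b = b
  ifSame fz (fs (fs fz)) a b = b
  ifSame (fs fz) fz a b = b
  ifSame (fs fz) (fs fz) a b = a
  ifSame (fs fz) (fs (fs fz)) a b = b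
  ifSame (fs (fs fz)) fz a b = b
  ifSame (fs (fs fz)) (fs fz) a b = b
  ifSame (fs (fs fz)) (fs (fs fz)) a b = a

  -- legDepth y u + hubDist y u is the distance from u to hub y, split into the part inside leg y and the rest.
  legDepth : Fin 3 → V → ℕ
  legDepth y (inj₁ _) = 0
  legDepth y (inj₂ (i , j)) = ifSame y i (suc (toℕ j)) 0

  hubDist : Fin 3 → V → ℕ
  hubDist y (inj₁ a) = cdist (toℕ a) (toℕ y * k)
  hubDist y (inj₂ (i , j)) = ifSame y i 0 (suc (toℕ j) + k)

  cnorm-k : cnorm k ≡ k
  cnorm-k = m≤n⇒m⊓n≡m (subst (k ≤_) (sym (3k∸k≡2k k')) (k≤2k k'))

  cnorm-2k : cnorm (2 * k) ≡ k
  cnorm-2k = trans (cong (2 * k ⊓_) (3k∸2k≡k k')) (m≥n⇒m⊓n≡n (k≤2k k'))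

  cdist-hubs : ∀ i y → cdist (toℕ i * k) (toℕ y * k) ≡ ifSame y i 0 k
  cdist-hubs fz fz = refl
  cdist-hubs fz (fs fz) = trans (cong cnorm (*-identityˡ k)) cnorm-k
  cdist-hubs fz (fs (fs fz)) = cnorm-2k
  cdist-hubs (fs fz) fz = trans (cong cnorm (trans (∣-∣-identityʳ (1 * k)) (*-identityˡ k))) cnorm-k
  cdist-hubs (fs fz) (fs fz) = cdist-self (1 * k)
  cdist-hubs (fs fz) (fs (fs fz)) = trans (cong cnorm (trans (cong (λ z → ∣ z - 2 * k ∣) (*-identityˡ k)) (∣m-m+n∣≡n k (k + 0)))) (trans (cong cnorm (+-identityʳ k)) cnorm-k)
  cdist-hubs (fs (fs fz)) fz = trans (cong cnorm (∣-∣-identityʳ (2 * k))) cnorm-2k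
  cdist-hubs (fs (fs fz)) (fs fz) = trans (cong cnorm (trans (∣-∣-comm (2 * k) (1 * k)) (trans (cong (λ z → ∣ z - 2 * k ∣) (*-identityˡ k)) (∣m-m+n∣≡n k (k + 0))))) (trans (cong cnorm (+-identityʳ k)) cnorm-k)
  cdist-hubs (fs (fs fz)) (fs (fs fz)) = cdist-self (2 * k)

  ifSame-cases : ∀ y i → ((∀ a b → ifSame y i a b ≡ a) × y ≡ i) ⊎ (∀ a b → ifSame y i a b ≡ b)
  ifSame-cases fz fz = inj₁ ((λ a b → refl) , refl)
  ifSame-cases fz (fs fz) = inj₂ (λ a b → refl)
  ifSame-cases fz (fs (fs fz)) = inj₂ (λ a b → refl)
  ifSame-cases (fs fz) fz = inj₂ (λ a b → refl)
  ifSame-cases (fs fz) (fs fz) = inj₁ ((λ a b → refl) , refl)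
  ifSame-cases (fs fz) (fs (fs fz)) = inj₂ (λ a b → refl)
  ifSame-cases (fs (fs fz)) fz = inj₂ (λ a b → refl)
  ifSame-cases (fs (fs fz)) (fs fz) = inj₂ (λ a b → refl)
  ifSame-cases (fs (fs fz)) (fs (fs fz)) = inj₁ ((λ a b → refl) , refl)

  potential-edge : ∀ y {u w} → TEdge k l u w → (legDepth y w + hubDist y u ≤ suc (legDepth y u + hubDist y w)) × (legDepth y u + hubDist y w ≤ suc (legDepth y w + hubDist y u))
  potential-edge y e@(cyc _ _ _) = cdist-cycEdge (hub<n y) e
  potential-edge y e@(cycWrap _ _ _ _) = cdist-cycEdge (hub<n y) e
  potential-edge y (attach a i j e1 e2) rewrite e1 | e2 | cdist-hubs i y with ifSame-cases y i
  ... | inj₁ (h , refl) rewrite h 1 0 | h 0 k | h 0 (suc k) = ≤-refl , z≤n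
  ... | inj₂ h rewrite h 1 0 | h 0 k | h 0 (suc k) = ≤-trans (n≤1+n k) (n≤1+n (suc k)) , ≤-refl
  potential-edge y (pathStep i j j' e) rewrite sym e with ifSame-cases y i
  ... | inj₁ (h , refl) rewrite h (suc (suc (toℕ j))) 0 | h (suc (toℕ j)) 0 | h 0 (suc (suc (toℕ j)) + k) | h 0 (suc (toℕ j) + k) =
        ≤-refl , ≤-trans (n≤1+n _) (n≤1+n _)
  ... | inj₂ h rewrite h (suc (suc (toℕ j))) 0 | h (suc (toℕ j)) 0 | h 0 (suc (suc (toℕ j)) + k) | h 0 (suc (toℕ j) + k) =
        ≤-trans (n≤1+n _) (n≤1+n _) , ≤-refl

  potential-step : ∀ y {u w} → Stp u w → legDepth y w + hubDist y u ≤ suc (legDepth y u + hubDist y w)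
  potential-step y (inj₁ refl) = n≤1+n _
  potential-step y (inj₂ (inj₁ e)) = proj₁ (potential-edge y e)
  potential-step y (inj₂ (inj₂ e)) = proj₂ (potential-edge y e)

  potential-reach : ∀ y {m u w} → Reach G m u w → legDepth y w + hubDist y u ≤ m + legDepth y u + hubDist y w
  potential-reach y {u = u} here = ≤-refl
  potential-reach y {suc m} {u} {w} (step {w = v} s r) =
    add (legDepth y w) (hubDist y v) (legDepth y v) (hubDist y w) (hubDist y u) (legDepth y u) m (potential-reach y r) (potential-step y s)
    where
    add : ∀ Dw Pv Dv Pw Pu Du m → Dw + Pv ≤ m + Dv + Pw → Dv + Pu ≤ suc (Du + Pv) → Dw + Pu ≤ suc m + Du + Pw
    add Dw Pv Dv Pw Pu Du m h1 h2 = ≤-balance (Dw + Pu) (suc m + Du + Pw) 0 (+-mono-≤ h1 h2) (solve (Dw ∷ Pv ∷ Dv ∷ Pw ∷ Pu ∷ Du ∷ m ∷ []))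

  cycPos : V → ℕ
  cycPos (inj₁ a) = toℕ a
  cycPos (inj₂ (i , j)) = toℕ i * k

  depth : V → ℕ
  depth (inj₁ _) = 0
  depth (inj₂ (i , j)) = suc (toℕ j)

  distToCyc : ℕ → V → ℕ
  distToCyc w0 u = depth u + cdist (cycPos u) w0

  distToCyc-edge : ∀ w0 {u w} → w0 < n → TEdge k l u w → (distToCyc w0 u ≤ suc (distToCyc w0 w)) × (distToCyc w0 w ≤ suc (distToCyc w0 u))
  distToCyc-edge w0 h e@(cyc _ _ _) = cdist-cycEdge h e
  distToCyc-edge w0 h e@(cycWrap _ _ _ _) = cdist-cycEdge h e
  distToCyc-edge w0 h (attach a i j e1 e2) rewrite e1 | e2 = ≤-trans (n≤1+n _) (n≤1+n _) , ≤-refl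
  distToCyc-edge w0 h (pathStep i j j' e) rewrite sym e = ≤-trans (n≤1+n _) (n≤1+n _) , ≤-refl

  distToCyc-step : ∀ w0 {u w} → w0 < n → Stp u w → distToCyc w0 u ≤ suc (distToCyc w0 w)
  distToCyc-step w0 h (inj₁ refl) = n≤1+n _
  distToCyc-step w0 h (inj₂ (inj₁ e)) = proj₁ (distToCyc-edge w0 h e)
  distToCyc-step w0 h (inj₂ (inj₂ e)) = proj₂ (distToCyc-edge w0 h e)

  distToCyc-reach : ∀ w0 {m u w} → w0 < n → Reach G m u w → distToCyc w0 u ≤ m + distToCyc w0 w
  distToCyc-reach w0 h here = ≤-refl
  distToCyc-reach w0 h (step s r) = ≤-trans (distToCyc-step w0 h s) (s≤s (distToCyc-reach w0 h r))

  cycV-nextPos : ∀ a → a < n → Stp (cycV a) (cycV (nextPos a))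
  cycV-nextPos a h with suc a <? n
  ... | yes h' = cycV-step a h'
  ... | no q rewrite nextPos-wrap a h q = cycV-wrap

  cycPos-step : ∀ {c c'} → Stp c c' → (cycPos c' ≡ cycPos c) ⊎ (cycPos c' ≡ nextPos (cycPos c)) ⊎ (cycPos c ≡ nextPos (cycPos c'))
  cycPos-step (inj₁ refl) = inj₁ refl
  cycPos-step (inj₂ (inj₁ e)) = forward e
    where
    forward : ∀ {c c'} → TEdge k l c c' → (cycPos c' ≡ cycPos c) ⊎ (cycPos c' ≡ nextPos (cycPos c)) ⊎ (cycPos c ≡ nextPos (cycPos c'))
    forward (cyc a b e) = inj₂ (inj₁ (trans (sym e) (sym (nextPos-suc (toℕ a) (subst (_< n) (sym e) (toℕ<n b))))))
    forward (cycWrap a b e1 e2) rewrite suc-injective e1 | e2 = inj₂ (inj₁ (sym nextPos-last))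
    forward (attach a i j e1 e2) = inj₁ (sym e1)
    forward (pathStep i j j' e) = inj₁ refl
  cycPos-step (inj₂ (inj₂ e)) = backward e
    where
    backward : ∀ {c c'} → TEdge k l c' c → (cycPos c' ≡ cycPos c) ⊎ (cycPos c' ≡ nextPos (cycPos c)) ⊎ (cycPos c ≡ nextPos (cycPos c'))
    backward (cyc a b e) = inj₂ (inj₂ (trans (sym e) (sym (nextPos-suc (toℕ a) (subst (_< n) (sym e) (toℕ<n b))))))
    backward (cycWrap a b e1 e2) rewrite suc-injective e1 | e2 = inj₂ (inj₂ (sym nextPos-last))
    backward (attach a i j e1 e2) = inj₁ e1
    backward (pathStep i j j' e) = inj₁ refl

  cycPos<n : ∀ c → cycPos c < n
  cycPos<n (inj₁ a) = toℕ<n a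
  cycPos<n (inj₂ (i , j)) = hub<n i

  far-cycV : ∀ ρ c y → y < n → ρ + 1 ≤ cdist (cycPos c) y → ¬ Reach G ρ c (cycV y)
  far-cycV ρ c y hy h r = 1+n≰n (≤-trans (subst (_≤ depth c + cdist (cycPos c) y) (+-comm ρ 1) (≤-trans h (m≤n+m _ (depth c)))) (≤-trans (distToCyc-reach y hy r) (≤-reflexive (trans (cong (λ z → ρ + (0 + cdist z y)) (toℕ-cycV y hy)) (trans (cong (λ z → ρ + z) (cdist-self y)) (+-identityʳ ρ))))))

  ifSame-same : ∀ y a b → ifSame y y a b ≡ a
  ifSame-same fz a b = refl
  ifSame-same (fs fz) a b = refl
  ifSame-same (fs (fs fz)) a b = refl

  ifSame-diff : ∀ y x a b → y ≢ x → ifSame y x a b ≡ b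
  ifSame-diff y x a b h with ifSame-cases y x
  ... | inj₁ (_ , e) = ⊥-elim (h e)
  ... | inj₂ g = g a b

  legDepth-leg : ∀ y d → d ≤ l → legDepth y (leg y d) ≡ d
  legDepth-leg y zero h = refl
  legDepth-leg y (suc d) h = trans (ifSame-same y _ 0) (cong suc (toℕ-clamp l' d (≤-pred h)))

  hubDist-leg : ∀ y d → hubDist y (leg y d) ≡ 0
  hubDist-leg y zero = trans (cong (λ z → cdist z (toℕ y * k)) (toℕ-cycV _ (hub<n y))) (cdist-self (toℕ y * k))
  hubDist-leg y (suc d) = ifSame-same y 0 _

  legDepth-otherLeg : ∀ y x d → y ≢ x → legDepth y (leg x d) ≡ 0
  legDepth-otherLeg y x zero h = refl
  legDepth-otherLeg y x (suc d) h = ifSame-diff y x _ 0 h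

  hubDist-otherLeg : ∀ y x d → y ≢ x → d ≤ l → hubDist y (leg x d) ≡ d + k
  hubDist-otherLeg y x zero h _ = trans (cong (λ z → cdist z (toℕ y * k)) (toℕ-cycV _ (hub<n x))) (trans (cdist-hubs x y) (ifSame-diff y x 0 k h))
  hubDist-otherLeg y x (suc d) h hd = trans (ifSame-diff y x 0 _ h) (cong (λ z → suc z + k) (toℕ-clamp l' d (≤-pred hd)))

  legDepth-pos : ∀ y c → 1 ≤ legDepth y c → (c ≡ leg y (legDepth y c)) × (legDepth y c ≤ l)
  legDepth-pos y (inj₁ a) ()
  legDepth-pos y (inj₂ (i , j)) h with ifSame-cases y i
  ... | inj₁ (g , refl) rewrite g (suc (toℕ j)) 0 = cong (λ z → inj₂ (y , z)) (sym (clamp-toℕ l' j)) , toℕ<n j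
  ... | inj₂ g rewrite g (suc (toℕ j)) 0 = ⊥-elim (1+n≰n (≤-trans h z≤n))

  leg-moves : ∀ i j c' → Stp (inj₂ (i , j)) c' →
    (c' ≡ inj₂ (i , j)) ⊎ (Σ (Fin l) λ j' → (c' ≡ inj₂ (i , j')) × (toℕ j' ≡ suc (toℕ j))) ⊎
    (Σ (Fin l) λ j' → (c' ≡ inj₂ (i , j')) × (suc (toℕ j') ≡ toℕ j)) ⊎ ((c' ≡ hub i) × (toℕ j ≡ 0))
  leg-moves i j c' (inj₁ refl) = inj₁ refl
  leg-moves i j c' (inj₂ (inj₁ (pathStep .i .j j' e))) = inj₂ (inj₁ (j' , refl , sym e))
  leg-moves i j c' (inj₂ (inj₂ (attach a .i .j e1 e2))) = inj₂ (inj₂ (inj₂ (cong inj₁ (toℕ-injective (trans e1 (sym (toℕ-cycV _ (hub<n i))))) , e2)))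
  leg-moves i j c' (inj₂ (inj₂ (pathStep .i j0 .j e))) = inj₂ (inj₂ (inj₁ (j0 , refl , e)))

  leg-interior-moves : ∀ x e c' → 1 ≤ e → e ≤ l → Stp (leg x e) c' →
            (c' ≡ leg x e) ⊎ (c' ≡ leg x (pred e)) ⊎ ((suc e ≤ l) × (c' ≡ leg x (suc e)))
  leg-interior-moves x (suc d) c' h1 h2 s with leg-moves x (clamp l' d) c' s
  ... | inj₁ e = inj₁ e
  ... | inj₂ (inj₁ (j' , e , t)) = inj₂ (inj₂ (subst (_≤ l) (cong suc tj) (toℕ<n j') , trans e (cong (λ z → inj₂ (x , z)) (trans (sym (clamp-toℕ l' j')) (cong (clamp l') tj)))))
    where
    tj : toℕ j' ≡ suc d
    tj = trans t (cong suc (toℕ-clamp l' d (≤-pred h2)))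
  ... | inj₂ (inj₂ (inj₁ (j' , e , t))) = inj₂ (inj₁ (trans e (trans (cong (λ z → inj₂ (x , z)) (sym (clamp-toℕ l' j'))) (cong (leg x) tj))))
    where
    tj : suc (toℕ j') ≡ d
    tj = trans t (toℕ-clamp l' d (≤-pred h2))
  ... | inj₂ (inj₂ (inj₂ (e , t))) = inj₂ (inj₁ (trans e (cong (leg x) (sym (trans (sym (toℕ-clamp l' d (≤-pred h2))) t)))))

  arc : Fin 3 → Dir → ℕ → ℕ
  arc fz fwd s = s
  arc (fs fz) fwd s = k + s
  arc (fs (fs fz)) fwd s with s <? k
  ... | yes _ = 2 * k + s
  ... | no _ = 0
  arc fz bwd zero = 0
  arc fz bwd (suc s) = m₀ ∸ s
  arc (fs fz) bwd s = k ∸ s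
  arc (fs (fs fz)) bwd s = 2 * k ∸ s

  ∣m+n-m∣≡n : ∀ b w → ∣ (b + w) - b ∣ ≡ w
  ∣m+n-m∣≡n b w = trans (∣-∣-comm (b + w) b) (∣m-m+n∣≡n b w)

  k≤cdist : ∀ a b w → (∣ a - b ∣ ≡ w) → k ≤ w → w ≤ 2 * k → k ≤ cdist a b
  k≤cdist a b w e h1 h2 = ≤-cdist a b k (subst (k ≤_) (sym e) h1) (subst (λ z → z + k ≤ n) (sym e) (≤-trans (+-monoˡ-≤ k h2) (≤-reflexive (eq k'))))
    where
    eq : ∀ k' → 2 * suc k' + suc k' ≡ 3 * suc k'
    eq k' = solve (k' ∷ [])

  arc<n : ∀ y d s → s ≤ k → arc y d s < n
  arc<n fz fwd s h = ≤-trans (s≤s h) (k<3k k')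
  arc<n (fs fz) fwd s h = k+s<3k k' s h
  arc<n (fs (fs fz)) fwd s h with s <? k
  ... | yes q = 2k+s<3k k' s q
  ... | no _ = s≤s z≤n
  arc<n fz bwd zero h = s≤s z≤n
  arc<n fz bwd (suc s) h = s≤s (m∸n≤m m₀ s)
  arc<n (fs fz) bwd s h = ≤-trans (s≤s (m∸n≤m k s)) (k<3k k')
  arc<n (fs (fs fz)) bwd s h = ≤-trans (s≤s (m∸n≤m (2 * k) s)) (2k<3k k')

  arc-0 : ∀ y d → arc y d 0 ≡ toℕ y * k
  arc-0 fz fwd = refl
  arc-0 (fs fz) fwd = refl
  arc-0 (fs (fs fz)) fwd with 0 <? k
  ... | yes _ = +-identityʳ (2 * k)
  ... | no q = ⊥-elim (q (s≤s z≤n))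
  arc-0 fz bwd = refl
  arc-0 (fs fz) bwd = sym (+-identityʳ k)
  arc-0 (fs (fs fz)) bwd = refl

  arc-k : ∀ y d → arc y d k ≡ toℕ (ahead y d) * k
  arc-k fz fwd = sym (+-identityʳ k)
  arc-k (fs fz) fwd = cong (k +_) (sym (+-identityʳ k))
  arc-k (fs (fs fz)) fwd with k <? k
  ... | yes q = ⊥-elim (<-irrefl refl q)
  ... | no _ = refl
  arc-k fz bwd = m+n∸m≡n k' (2 * k)
  arc-k (fs fz) bwd = n∸n≡0 k
  arc-k (fs (fs fz)) bwd = m+n∸m≡n k (k + 0)

  arc-step : ∀ y d s → suc s ≤ k → Stp (cycV (arc y d s)) (cycV (arc y d (suc s)))
  arc-step fz fwd s h = cycV-step s (≤-trans (s≤s h) (k<3k k'))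
  arc-step (fs fz) fwd s h = subst (λ z → Stp (cycV (k + s)) (cycV z)) (sym (+-suc k s)) (cycV-step (k + s) (subst (_< n) (+-suc k s) (k+s<3k k' (suc s) h)))
  arc-step (fs (fs fz)) fwd s h with s <? k | suc s <? k
  ... | yes q | yes q' = subst (λ z → Stp (cycV (2 * k + s)) (cycV z)) (sym (+-suc (2 * k) s)) (cycV-step (2 * k + s) (subst (_< n) (+-suc (2 * k) s) (2k+s<3k k' (suc s) q')))
  ... | yes q | no q' = subst (λ z → Stp (cycV z) (cycV 0)) (sym (last-step≡ k' s q q')) cycV-wrap
  ... | no q | _ = ⊥-elim (q h)
  arc-step fz bwd zero h = Step-sym cycV-wrap
  arc-step fz bwd (suc s) h = subst (λ z → Stp (cycV z) (cycV (m₀ ∸ suc s))) (sym (∸-sucʳ m₀ s s≤m)) (Step-sym (cycV-step (m₀ ∸ suc s) (s≤s (subst (_≤ m₀) (∸-sucʳ m₀ s s≤m) (m∸n≤m m₀ s)))))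
    where
    s≤m : suc s ≤ m₀
    s≤m = ≤-trans (≤-pred h) (m≤m+n k' (2 * k))
  arc-step (fs fz) bwd s h = subst (λ z → Stp (cycV z) (cycV (k ∸ suc s))) (sym (∸-sucʳ k s h)) (Step-sym (cycV-step (k ∸ suc s) (subst (_< n) (∸-sucʳ k s h) (≤-trans (s≤s (m∸n≤m k s)) (k<3k k')))))
  arc-step (fs (fs fz)) bwd s h = subst (λ z → Stp (cycV z) (cycV (2 * k ∸ suc s))) (sym (∸-sucʳ (2 * k) s h2)) (Step-sym (cycV-step (2 * k ∸ suc s) (subst (_< n) (∸-sucʳ (2 * k) s h2) (≤-trans (s≤s (m∸n≤m (2 * k) s)) (2k<3k k')))))
    where
    h2 : suc s ≤ 2 * k
    h2 = ≤-trans h (k≤2k k')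

  arc-far : ∀ y d s → s ≤ k → k ≤ cdist (arc y d s) (toℕ (behind y d) * k)
  arc-far fz fwd s h with m≤n⇒∃[o]m+o≡n h
  ... | r , e = k≤cdist s (2 * k) (r + k) (trans (cong (λ z → ∣ s - z ∣) (s+r≡k⇒2k≡s+[r+k] k s r e)) (∣m-m+n∣≡n s (r + k))) (m≤n+m k r) (r≤k⇒r+k≤2k k r (subst (r ≤_) e (m≤n+m r s)))
  arc-far (fs fz) fwd s h = k≤cdist (k + s) 0 (k + s) (∣-∣-identityʳ (k + s)) (m≤m+n k s) (r≤k⇒k+r≤2k k s h)
  arc-far (fs (fs fz)) fwd s h with s <? k
  ... | yes q = k≤cdist (2 * k + s) (k + 0) (k + s) (trans (cong (λ z → ∣ z - (k + 0) ∣) (2k+s≡k+0+[k+s] k s)) (∣m+n-m∣≡n (k + 0) (k + s))) (m≤m+n k s) (r≤k⇒k+r≤2k k s h)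
  ... | no q = k≤cdist 0 (k + 0) (k + 0) refl (≤-reflexive (sym (+-identityʳ k))) (r≤k⇒k+r≤2k k 0 z≤n)
  arc-far fz bwd zero h = k≤cdist 0 (k + 0) (k + 0) refl (≤-reflexive (sym (+-identityʳ k))) (r≤k⇒k+r≤2k k 0 z≤n)
  arc-far fz bwd (suc s) h with m≤n⇒∃[o]m+o≡n (≤-pred h)
  ... | r , e = k≤cdist (m₀ ∸ s) (k + 0) (r + k) (trans (cong (λ z → ∣ z - (k + 0) ∣) (trans (cong (_∸ s) (s+r≡k'⇒k'+2k≡s+[r+2k] k' s r e)) (m+n∸m≡n s (r + 2 * k)))) (trans (cong (λ z → ∣ z - (k + 0) ∣) (r+2k≡k+0+[r+k] k r)) (∣m+n-m∣≡n (k + 0) (r + k)))) (m≤n+m k r) (r≤k⇒r+k≤2k k r (≤-trans (subst (r ≤_) e (m≤n+m r s)) (n≤1+n k')))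
  arc-far (fs fz) bwd s h with m≤n⇒∃[o]m+o≡n h
  ... | r , e = k≤cdist (k ∸ s) (2 * k) (k + s) (trans (cong (λ z → ∣ z - 2 * k ∣) (trans (cong (_∸ s) (sym e)) (m+n∸m≡n s r))) (trans (cong (λ z → ∣ r - z ∣) (s+r≡k⇒2k≡r+[k+s] k s r e)) (∣m-m+n∣≡n r (k + s)))) (m≤m+n k s) (r≤k⇒k+r≤2k k s h)
  arc-far (fs (fs fz)) bwd s h with m≤n⇒∃[o]m+o≡n h
  ... | r , e = k≤cdist (2 * k ∸ s) 0 (k + r) (trans (cong (λ z → ∣ z - 0 ∣) (trans (cong (_∸ s) (s+r≡k⇒2k≡s+[k+r] k s r e)) (m+n∸m≡n s (k + r)))) (∣-∣-identityʳ (k + r))) (m≤m+n k r) (r≤k⇒k+r≤2k k r (subst (r ≤_) e (m≤n+m r s)))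

  cycV-reach-up : ∀ a j → a + j < n → Reach G j (cycV a) (cycV (a + j))
  cycV-reach-up a zero h = subst (λ z → Reach G 0 (cycV a) (cycV z)) (sym (+-identityʳ a)) here
  cycV-reach-up a (suc j) h = step (cycV-step a (≤-trans (s≤s (s≤s (m≤m+n a j))) (subst (_≤ n) (cong suc (+-suc a j)) h))) (subst (λ z → Reach G j (cycV (suc a)) (cycV z)) (sym (+-suc a j)) (cycV-reach-up (suc a) j (subst (_< n) (+-suc a j) h)))

  cycV-reach-≤ : ∀ a b → a ≤ b → b < n → Reach G (b ∸ a) (cycV a) (cycV b)
  cycV-reach-≤ a b h hb = subst (λ z → Reach G (b ∸ a) (cycV a) (cycV z)) (m+[n∸m]≡n h) (cycV-reach-up a (b ∸ a) (subst (_< n) (sym (m+[n∸m]≡n h)) hb))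

  cycV-reach-wrap : ∀ a b → a ≤ b → b < n → Reach G (suc (m₀ ∸ b) + a) (cycV b) (cycV a)
  cycV-reach-wrap a b h hb = Reach-trans (Reach-snoc (cycV-reach-≤ b m₀ (≤-pred hb) ≤-refl) cycV-wrap) (cycV-reach-≤ 0 a z≤n (≤-<-trans h hb))

  wrap-length : ∀ m₀ a b → a ≤ b → b ≤ m₀ → suc (m₀ ∸ b) + a ≡ suc m₀ ∸ (b ∸ a)
  wrap-length m₀ a b h1 h2 with m≤n⇒∃[o]m+o≡n h1 | m≤n⇒∃[o]m+o≡n h2
  ... | w , e1 | v , e2 rewrite sym e1 | sym e2 | m+n∸m≡n a w | m+n∸m≡n (a + w) v = sym (trans (cong (_∸ w) (eq a w v)) (m+n∸n≡m (suc (v + a)) w))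
    where
    eq : ∀ a w v → suc (a + w + v) ≡ suc (v + a) + w
    eq a w v = solve (a ∷ w ∷ v ∷ [])

  cycV-reach-cdist-≤ : ∀ a b → a ≤ b → b < n → Reach G (cdist a b) (cycV a) (cycV b)
  cycV-reach-cdist-≤ a b h hb with (b ∸ a) ≤? (n ∸ (b ∸ a))
  ... | yes q = subst (λ z → Reach G z (cycV a) (cycV b)) (sym (trans (cong cnorm (m≤n⇒∣m-n∣≡n∸m h)) (m≤n⇒m⊓n≡m q))) (cycV-reach-≤ a b h hb)
  ... | no q = subst (λ z → Reach G z (cycV a) (cycV b)) (sym (trans (cong cnorm (m≤n⇒∣m-n∣≡n∸m h)) (trans (m≥n⇒m⊓n≡n (<⇒≤ (≰⇒> q))) (sym (wrap-length m₀ a b h (≤-pred hb)))))) (Reach-sym (cycV-reach-wrap a b h hb))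

  cycV-reach-cdist : ∀ a b → a < n → b < n → Reach G (cdist a b) (cycV a) (cycV b)
  cycV-reach-cdist a b ha hb with ≤-total a b
  ... | inj₁ h = cycV-reach-cdist-≤ a b h hb
  ... | inj₂ h = subst (λ z → Reach G z (cycV a) (cycV b)) (cdist-sym b a) (Reach-sym (cycV-reach-cdist-≤ b a h ha))

  leg-reach-up : ∀ y a j → a + j ≤ l → Reach G j (leg y a) (leg y (a + j))
  leg-reach-up y a zero h = subst (λ z → Reach G 0 (leg y a) (leg y z)) (sym (+-identityʳ a)) here
  leg-reach-up y a (suc j) h = step (leg-step y a (≤-trans (s≤s (m≤m+n a j)) (subst (_≤ l) (+-suc a j) h))) (subst (λ z → Reach G j (leg y (suc a)) (leg y z)) (sym (+-suc a j)) (leg-reach-up y (suc a) j (subst (_≤ l) (+-suc a j) h)))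

  leg-reach-≤ : ∀ y a b → a ≤ b → b ≤ l → Reach G (b ∸ a) (leg y a) (leg y b)
  leg-reach-≤ y a b h hb = subst (λ z → Reach G (b ∸ a) (leg y a) (leg y z)) (m+[n∸m]≡n h) (leg-reach-up y a (b ∸ a) (subst (_≤ l) (sym (m+[n∸m]≡n h)) hb))

  leg-reach : ∀ y a b → a ≤ l → b ≤ l → Reach G ∣ a - b ∣ (leg y a) (leg y b)
  leg-reach y a b ha hb with ≤-total a b
  ... | inj₁ h = subst (λ z → Reach G z (leg y a) (leg y b)) (sym (m≤n⇒∣m-n∣≡n∸m h)) (leg-reach-≤ y a b h hb)
  ... | inj₂ h = subst (λ z → Reach G z (leg y a) (leg y b)) (sym (m≤n⇒∣n-m∣≡n∸m h)) (Reach-sym (leg-reach-≤ y b a h ha))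

  leg-reach-hub : ∀ x e y → e ≤ l → Reach G (e + cdist (toℕ x * k) (toℕ y * k)) (leg x e) (hub y)
  leg-reach-hub x e y h = Reach-trans (subst (λ z → Reach G z (leg x e) (leg x 0)) (∣-∣-identityʳ e) (leg-reach x e 0 h z≤n)) (cycV-reach-cdist _ _ (hub<n x) (hub<n y))

  cycV-toℕ : ∀ (a : Fin n) → cycV (toℕ a) ≡ inj₁ a
  cycV-toℕ a = cong inj₁ (clamp-toℕ m₀ a)

  cdist≡0⇒≡ : ∀ a b → a < n → b < n → cdist a b ≡ 0 → a ≡ b
  cdist≡0⇒≡ a b ha hb e with ⊓-sel ∣ a - b ∣ (n ∸ ∣ a - b ∣)
  ... | inj₁ x = ∣m-n∣≡0⇒m≡n (trans (sym x) e)
  ... | inj₂ x = ⊥-elim (<-irrefl refl (≤-trans (∣-∣< a b ha hb) (m∸n≡0⇒m≤n (trans (sym x) e))))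

  ≡hub : ∀ y u → legDepth y u ≡ 0 → hubDist y u ≡ 0 → u ≡ hub y
  ≡hub y (inj₁ a) _ e = trans (sym (cycV-toℕ a)) (cong cycV (cdist≡0⇒≡ _ _ (toℕ<n a) (hub<n y) e))
  ≡hub y (inj₂ (i , j)) e1 e2 with ifSame-cases y i
  ... | inj₁ (g , refl) = ⊥-elim (1+n≢0 (trans (sym (g (suc (toℕ j)) 0)) e1))
  ... | inj₂ g = ⊥-elim (1+n≢0 (trans (sym (g 0 (suc (toℕ j) + k))) e2))

  enters-leg-from-hub : ∀ y {u u'} → Stp u u' → legDepth y u ≡ 0 → 1 ≤ legDepth y u' → u ≡ hub y
  enters-leg-from-hub y {u} {u'} s e h with legDepth-pos y u' h
  ... | eu' , _ = ≡hub y u e (n≤0⇒n≡0 (≤-pred (≤-trans (+-monoˡ-≤ (hubDist y u) h) (≤-trans (potential-step y s) (≤-reflexive (cong suc (trans (cong (_+ hubDist y u') e) (trans (cong (hubDist y) eu') (hubDist-leg y (legDepth y u'))))))))))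

  legDepth≤l : ∀ y u → legDepth y u ≤ l
  legDepth≤l y (inj₁ a) = z≤n
  legDepth≤l y (inj₂ (i , j)) with ifSame-cases y i
  ... | inj₁ (g , refl) = subst (_≤ l) (sym (g _ 0)) (toℕ<n j)
  ... | inj₂ g = subst (_≤ l) (sym (g _ 0)) z≤n

  hubDist-onLeg : ∀ y u → 1 ≤ legDepth y u → hubDist y u ≡ 0
  hubDist-onLeg y u h = trans (cong (hubDist y) (proj₁ (legDepth-pos y u h))) (hubDist-leg y (legDepth y u))

  legDepth-step : ∀ y {u u'} → Stp u u' → 1 ≤ legDepth y u → legDepth y u ≤ suc (legDepth y u')
  legDepth-step y {u} {u'} s h = subst (λ z → legDepth y u ≤ suc z) (+-identityʳ _) (≤-trans (m≤m+n (legDepth y u) (hubDist y u')) (≤-trans (potential-step y (Step-sym s)) (≤-reflexive (cong (λ z → suc (legDepth y u' + z)) (hubDist-onLeg y u h)))))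

  hubDist-step : ∀ y {u u'} → Stp u u' → legDepth y u ≡ 0 → legDepth y u' ≡ 0 → hubDist y u ≤ suc (hubDist y u')
  hubDist-step y {u} {u'} s e e' = subst (_≤ suc (hubDist y u')) (cong (_+ hubDist y u) e') (subst (λ z → legDepth y u' + hubDist y u ≤ suc z) (cong (_+ hubDist y u') e) (potential-step y s))

  ifSame-0≤ : ∀ y i a → ifSame y i 0 a ≤ a
  ifSame-0≤ y i a with ifSame-cases y i
  ... | inj₁ (g , _) = subst (_≤ a) (sym (g 0 a)) z≤n
  ... | inj₂ g = subst (_≤ a) (sym (g 0 a)) ≤-refl

  inj₂≡leg : ∀ i (j : Fin l) → inj₂ (i , j) ≡ leg i (suc (toℕ j))
  inj₂≡leg i j = cong (λ z → inj₂ (i , z)) (sym (clamp-toℕ l' j))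

module CycleStrategy (k' l' ρ : ℕ) (long-cycle : 2 * ρ + 2 < 3 * suc k') where
  open Tkl k' l'
  open RobberGame G ρ

  2ρ+3≤n : (ρ + 1) + suc (ρ + 1) ≤ n
  2ρ+3≤n = subst (_≤ n) (eq ρ) long-cycle
    where
    eq : ∀ ρ → suc (2 * ρ + 2) ≡ (ρ + 1) + suc (ρ + 1)
    eq ρ = solve (ρ ∷ [])

  ρ+2<n : suc (ρ + 1) < n
  ρ+2<n = ≤-trans (+-monoˡ-≤ (suc (ρ + 1)) (m≤n+m 1 ρ)) 2ρ+3≤n

  ρ+1≤cnorm[ρ+1] : ρ + 1 ≤ cnorm (ρ + 1)
  ρ+1≤cnorm[ρ+1] = ⊓-glb ≤-refl (m+n≤o⇒m≤o∸n (ρ + 1) (≤-trans (+-monoʳ-≤ (ρ + 1) (n≤1+n _)) 2ρ+3≤n))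

  ρ+1≤cnorm[ρ+2] : ρ + 1 ≤ cnorm (suc (ρ + 1))
  ρ+1≤cnorm[ρ+2] = ⊓-glb (n≤1+n _) (m+n≤o⇒m≤o∸n (ρ + 1) 2ρ+3≤n)

  Valid : V → ℕ → Set
  Valid c x = x < n × ρ + 1 ≤ cdist (cycPos c) x × ρ + 1 ≤ cdist (cycPos c) (nextPos x)

  Hides : V → ℕ → V → Set
  Hides c x u = u ≡ cycV x ⊎ u ≡ cycV (nextPos x)

  start : ∀ c → Σ ℕ (Valid c)
  start c = x , rotate<n π (ρ + 1) (<-trans (n<1+n _) ρ+2<n) , far-x , far-next
    where
    π = cycPos c
    x = rotate π (ρ + 1)
    far-x : ρ + 1 ≤ cdist π x
    far-x = subst (λ z → ρ + 1 ≤ cdist z x) (rotate-0 π (cycPos<n c))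
              (subst (ρ + 1 ≤_) (sym (cdist-rotate π 0 (ρ + 1) (s≤s z≤n) (<-trans (n<1+n _) ρ+2<n))) ρ+1≤cnorm[ρ+1])
    far-next : ρ + 1 ≤ cdist π (nextPos x)
    far-next = subst (λ z → ρ + 1 ≤ cdist z (nextPos x)) (rotate-0 π (cycPos<n c))
                 (subst (λ z → ρ + 1 ≤ cdist (rotate π 0) z) (rotate-nextPos π (ρ + 1))
                   (subst (ρ + 1 ≤_) (sym (cdist-rotate π 0 (nextPos (ρ + 1)) (s≤s z≤n) (nextPos<n _)))
                     (subst (λ z → ρ + 1 ≤ cdist 0 z) (sym (nextPos-suc (ρ + 1) ρ+2<n)) ρ+1≤cnorm[ρ+2])))

  hides-far : ∀ c x → Valid c x → ∀ u → Hides c x u → Far c u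
  hides-far c x (x<n , far-x , far-next) u (inj₁ refl) = far-cycV ρ c x x<n far-x
  hides-far c x (x<n , far-x , far-next) u (inj₂ refl) = far-cycV ρ c (nextPos x) (nextPos<n x) far-next

  respond : ∀ c c' → Stp c c' → ∀ x → Valid c x → Σ ℕ λ x' → Valid c' x' × MovesInto c' (Hides c x) (Hides c' x')
  respond c c' s x (x<n , h1 , h2) with cycPos-step s
  ... | inj₁ e = x , (x<n , h1' , h2') , moves
    where
    h1' = subst (λ z → ρ + 1 ≤ cdist z x) (sym e) h1
    h2' = subst (λ z → ρ + 1 ≤ cdist z (nextPos x)) (sym e) h2
    moves : MovesInto c' (Hides c x) (Hides c' x)
    moves u' (inj₁ refl) = cycV x , inj₁ refl , far-cycV ρ c' x x<n h1' , inj₁ refl , far-cycV ρ c' x x<n h1'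
    moves u' (inj₂ refl) = cycV (nextPos x) , inj₂ refl , far-cycV ρ c' _ (nextPos<n x) h2' , inj₁ refl , far-cycV ρ c' _ (nextPos<n x) h2'
  ... | inj₂ (inj₁ e) = nextPos x , (nextPos<n x , g1 , g2) , moves
    where
    g1 : ρ + 1 ≤ cdist (cycPos c') (nextPos x)
    g1 = subst (λ z → ρ + 1 ≤ cdist z (nextPos x)) (sym e) (subst (ρ + 1 ≤_) (sym (cdist-nextPos _ _ (cycPos<n c) x<n)) h1)
    g2 : ρ + 1 ≤ cdist (cycPos c') (nextPos (nextPos x))
    g2 = subst (λ z → ρ + 1 ≤ cdist z (nextPos (nextPos x))) (sym e) (subst (ρ + 1 ≤_) (sym (cdist-nextPos _ _ (cycPos<n c) (nextPos<n x))) h2)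
    moves : MovesInto c' (Hides c x) (Hides c' (nextPos x))
    moves u' (inj₁ refl) = cycV (nextPos x) , inj₂ refl , far-cycV ρ c' _ (nextPos<n x) g1 , inj₁ refl , far-cycV ρ c' _ (nextPos<n x) g1
    moves u' (inj₂ refl) = cycV (nextPos x) , inj₂ refl , far-cycV ρ c' _ (nextPos<n x) g1 , cycV-nextPos _ (nextPos<n x) , far-cycV ρ c' _ (nextPos<n _) g2
  ... | inj₂ (inj₂ e) = prevPos x , (prevPos<n x x<n , g1 , g2) , moves
    where
    np : nextPos (prevPos x) ≡ x
    np = nextPos-prevPos x x<n
    g1 : ρ + 1 ≤ cdist (cycPos c') (prevPos x)
    g1 = subst (ρ + 1 ≤_) (cdist-nextPos _ _ (cycPos<n c') (prevPos<n x x<n)) (subst (λ z → ρ + 1 ≤ cdist z (nextPos (prevPos x))) e (subst (λ z → ρ + 1 ≤ cdist (cycPos c) z) (sym np) h1))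
    g2 : ρ + 1 ≤ cdist (cycPos c') (nextPos (prevPos x))
    g2 = subst (λ z → ρ + 1 ≤ cdist (cycPos c') z) (sym np) (subst (ρ + 1 ≤_) (cdist-nextPos _ _ (cycPos<n c') x<n) (subst (λ z → ρ + 1 ≤ cdist z (nextPos x)) e h2))
    g2' : ρ + 1 ≤ cdist (cycPos c') x
    g2' = subst (λ z → ρ + 1 ≤ cdist (cycPos c') z) np g2
    moves : MovesInto c' (Hides c x) (Hides c' (prevPos x))
    moves u' (inj₁ refl) = cycV x , inj₁ refl , far-cycV ρ c' x x<n g2' , Step-sym (subst (λ z → Stp (cycV (prevPos x)) (cycV z)) np (cycV-nextPos _ (prevPos<n x x<n))) , far-cycV ρ c' _ (prevPos<n x x<n) g1
    moves u' (inj₂ refl) = cycV x , inj₁ refl , far-cycV ρ c' x x<n g2' , subst (λ z → Stp (cycV x) (cycV z)) (sym np) (inj₁ refl) , far-cycV ρ c' _ (nextPos<n _) g2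

  ¬copWins : ¬ CopWins G ρ
  ¬copWins = strategy⇒¬CopWins (record
    { State = ℕ ; Valid = Valid ; Hides = Hides ; start = start ; hides-far = hides-far
    ; hides-some = λ c x _ → cycV x , inj₁ refl ; respond = respond })

module LegStrategy (k' l' ρ : ℕ) (short-cycle : 3 * suc k' ≤ 2 * ρ + 2) (long-legs : 4 * ρ + 2 < 2 * suc l' + suc k') where
  open Tkl k' l'
  open RobberGame G ρ

  4ρ+3≤2l+k : 4 * ρ + 3 ≤ 2 * l + k
  4ρ+3≤2l+k = subst (_≤ 2 * l + k) (sym (+-suc (4 * ρ) 2)) long-legs

  k≤ρ : k ≤ ρ
  k≤ρ = 3k≤2ρ+2⇒k≤ρ k ρ short-cycle

  θ : ℕ
  θ = ρ + 1 ∸ k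

  θ+k≡ρ+1 : θ + k ≡ ρ + 1
  θ+k≡ρ+1 = m∸n+n≡m (≤-trans k≤ρ (m≤m+n ρ 1))

  1≤θ : 1 ≤ θ
  1≤θ = m+n≤o⇒m≤o∸n 1 (subst (_≤ ρ + 1) (+-comm k 1) (+-monoˡ-≤ 1 k≤ρ))

  -- The least depth on leg y out of reach of a cop at c (the robber sits there or one deeper).
  frontier : Fin 3 → V → ℕ
  frontier y c = (legDepth y c + (ρ + 1)) ∸ hubDist y c

  AtFrontier : Fin 3 → V → V → Set
  AtFrontier y c u = (u ≡ leg y (frontier y c)) ⊎ (u ≡ leg y (suc (frontier y c) ⊓ l))

  OnArc : Fin 3 → Dir → ℕ → V → Set
  OnArc y d s u = (u ≡ cycV (arc y d s)) ⊎ (u ≡ cycV (arc y d (suc s)))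

  frontier-step : ∀ y {c c'} → Stp c c' → (frontier y c' ≤ suc (frontier y c)) × (frontier y c ≤ suc (frontier y c'))
  frontier-step y {c} {c'} s = shift (legDepth y c) (hubDist y c) (legDepth y c') (hubDist y c') (ρ + 1) (potential-step y s) ,
                               shift (legDepth y c') (hubDist y c') (legDepth y c) (hubDist y c) (ρ + 1) (potential-step y (Step-sym s))
    where
    shift : ∀ D P D' P' r → D' + P ≤ suc (D + P') → (D' + r) ∸ P' ≤ suc ((D + r) ∸ P)
    shift D P D' P' r h = m≤n+o⇒m∸n≤o (D' + r) P' (≤-balance (D' + r) (P' + suc ((D + r) ∸ P)) 0 (+-mono-≤ h (m≤n+m∸n (D + r) P)) (eq D P D' P' r ((D + r) ∸ P)))
      where
      eq : ∀ D P D' P' r x → P' + suc x + (D' + P + (D + r)) ≡ D' + r + 0 + (suc (D + P') + (P + x))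
      eq D P D' P' r x = solve (D ∷ P ∷ D' ∷ P' ∷ r ∷ x ∷ [])

  far-beyond-frontier : ∀ y c d → d ≤ l → frontier y c ≤ d → Far c (leg y d)
  far-beyond-frontier y c d hd ht r = contradiction (legDepth y c) (hubDist y c) ht (on-leg (potential-reach y r))
    where
    on-leg : legDepth y (leg y d) + hubDist y c ≤ ρ + legDepth y c + hubDist y (leg y d) → d + hubDist y c ≤ ρ + legDepth y c + 0
    on-leg h rewrite legDepth-leg y d hd | hubDist-leg y d = h
    contradiction : ∀ D P → (D + (ρ + 1)) ∸ P ≤ d → d + P ≤ ρ + D + 0 → ⊥
    contradiction D P h1 h2 = 1+n≰n (≤-trans (≤-balance (suc (D + ρ)) (D + (ρ + 1)) 0 {0} {0} ≤-refl (eq D ρ)) (≤-trans (m∸n≤o⇒m≤o+n _ P d h1) (≤-trans h2 (≤-reflexive (eq′ ρ D)))))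
      where
      eq : ∀ D ρ → D + (ρ + 1) + 0 ≡ suc (D + ρ) + 0 + 0
      eq D ρ = solve (D ∷ ρ ∷ [])
      eq′ : ∀ ρ D → ρ + D + 0 ≡ D + ρ
      eq′ ρ D = solve (ρ ∷ D ∷ [])

  far-arc : ∀ y d s e → s ≤ k → 1 ≤ e → e ≤ l → ρ + 1 ≤ e + k → Far (leg (behind y d) e) (cycV (arc y d s))
  far-arc y d s e hs he1 he2 hk r = 1+n≰n (begin
    suc ρ                                 ≡⟨ +-comm 1 ρ ⟩
    ρ + 1                                 ≤⟨ hk ⟩
    e + k                                 ≤⟨ +-monoʳ-≤ e k≤hubDist ⟩
    e + hubDist x (cycV (arc y d s))     ≤⟨ on-leg (potential-reach x (Reach-sym r)) ⟩
    ρ + 0 + 0                             ≡⟨ cong (_+ 0) (+-identityʳ ρ) ⟩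
    ρ + 0                                 ≡⟨ +-identityʳ ρ ⟩
    ρ                                     ∎)
    where
    open ≤-Reasoning
    x = behind y d
    k≤hubDist : k ≤ hubDist x (cycV (arc y d s))
    k≤hubDist = subst (k ≤_) (cong (λ z → cdist z (toℕ x * k)) (sym (toℕ-cycV _ (arc<n y d s hs)))) (arc-far y d s hs)
    on-leg : legDepth x (leg x e) + hubDist x (cycV (arc y d s)) ≤ ρ + legDepth x (cycV (arc y d s)) + hubDist x (leg x e) → e + hubDist x (cycV (arc y d s)) ≤ ρ + 0 + 0
    on-leg h rewrite legDepth-leg x e he2 | hubDist-leg x e = h

  θ+ρ+1≤l : θ + (ρ + 1) ≤ l
  θ+ρ+1≤l = *-cancelˡ-≤ 2 (≤-balance (2 * (θ + (ρ + 1))) (2 * l) 0 (+-mono-≤ (+-mono-≤ 4ρ+3≤2l+k (*-monoʳ-≤ 2 (≤-reflexive θ+k≡ρ+1))) (s≤s (z≤n {k'}))) (eq ρ θ k l))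
    where
    eq : ∀ ρ θ k l → 2 * l + (4 * ρ + 3 + 2 * (θ + k) + 1) ≡ 2 * (θ + (ρ + 1)) + 0 + (2 * l + k + 2 * (ρ + 1) + k)
    eq ρ θ k l = solve (ρ ∷ θ ∷ k ∷ l ∷ [])

  θ≤e⇒ρ+1≤e+k : ∀ e → θ ≤ e → ρ + 1 ≤ e + k
  θ≤e⇒ρ+1≤e+k e h = subst (_≤ e + k) θ+k≡ρ+1 (+-monoˡ-≤ k h)

  dash-depth : ∀ e e' s → e ≤ suc e' → ρ + 1 ≤ e + s → suc s ≤ k → θ ≤ e'
  dash-depth e e' s h1 h2 h3 = ≤-balance θ e' 0 (+-mono-≤ (+-mono-≤ h1 h2) (+-mono-≤ h3 (≤-reflexive θ+k≡ρ+1))) (eq ρ θ k e e' s)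
    where
    eq : ∀ ρ θ k e e' s → e' + (e + (ρ + 1) + (suc s + (θ + k))) ≡ θ + 0 + (suc e' + (e + s) + (k + (ρ + 1)))
    eq ρ θ k e e' s = solve (ρ ∷ θ ∷ k ∷ e ∷ e' ∷ s ∷ [])

  -- Once the cop's leg ends within ρ + 1 beyond him, the robber there is given up; the long legs keep the arc robber out of reach.
  dash-start : ∀ e s → θ + s ≡ e → ¬ (suc e + (ρ + 1) ≤ l) → ρ + 1 ≤ suc e + s
  dash-start e s refl q = ≤-balance (ρ + 1) (suc (θ + s) + s) 0 (+-mono-≤ (+-mono-≤ 4ρ+3≤2l+k (*-monoʳ-≤ 2 (≤-pred (≰⇒> q)))) (≤-reflexive θ+k≡ρ+1)) (eq ρ θ k l s)
    where
    eq : ∀ ρ θ k l s → suc (θ + s) + s + (4 * ρ + 3 + 2 * l + (θ + k)) ≡ ρ + 1 + 0 + (2 * l + k + 2 * (θ + s + (ρ + 1)) + (ρ + 1))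
    eq ρ θ k l s = solve (ρ ∷ θ ∷ k ∷ l ∷ s ∷ [])

  frontier≤l : ∀ y c → legDepth y c ≤ θ → frontier y c ≤ l
  frontier≤l y c h = ≤-trans (m∸n≤m _ (hubDist y c)) (≤-trans (+-monoˡ-≤ (ρ + 1) h) θ+ρ+1≤l)

  frontier-ownLeg : ∀ x e → e ≤ l → frontier x (leg x e) ≡ e + (ρ + 1)
  frontier-ownLeg x e h rewrite legDepth-leg x e h | hubDist-leg x e = refl

  frontier-otherLeg : ∀ y x e → y ≢ x → e ≤ l → frontier y (leg x e) ≡ (ρ + 1) ∸ (e + k)
  frontier-otherLeg y x e h hd rewrite legDepth-otherLeg y x e h | hubDist-otherLeg y x e h hd = refl

  frontier-otherLeg≡0 : ∀ y x e → y ≢ x → e ≤ l → ρ + 1 ≤ e + k → frontier y (leg x e) ≡ 0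
  frontier-otherLeg≡0 y x e h hd h2 = trans (frontier-otherLeg y x e h hd) (m≤n⇒m∸n≡0 h2)

  leg-adjacent : ∀ y a b → a ≤ l → b ≤ l → (b ≡ a) ⊎ (b ≡ suc a) ⊎ (a ≡ suc b) → Stp (leg y a) (leg y b)
  leg-adjacent y a b ha hb (inj₁ refl) = inj₁ refl
  leg-adjacent y a b ha hb (inj₂ (inj₁ refl)) = leg-step y a hb
  leg-adjacent y a b ha hb (inj₂ (inj₂ refl)) = Step-sym (leg-step y b ha)

  suc⊓l≤l : ∀ x → suc x ⊓ l ≤ l
  suc⊓l≤l x = m⊓n≤n (suc x) l

  suc⊓l-cases : ∀ x → x ≤ l → (suc x ⊓ l ≡ suc x) ⊎ (suc x ⊓ l ≡ x)
  suc⊓l-cases x h with suc x ≤? l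
  ... | yes q = inj₁ (m≤n⇒m⊓n≡m q)
  ... | no q = inj₂ (trans (m≥n⇒m⊓n≡n (≤-trans (≤-pred (≰⇒> q)) (n≤1+n x))) (≤-antisym (≤-pred (≰⇒> q)) h))

  ≤suc⊓l : ∀ x → x ≤ l → x ≤ suc x ⊓ l
  ≤suc⊓l x h = ⊓-glb (n≤1+n x) h

  frontier-follows : ∀ y {c c'} → Stp c c' → frontier y c ≤ l → frontier y c' ≤ l → MovesInto c' (AtFrontier y c) (AtFrontier y c')
  frontier-follows y {c} {c'} s ht ht' u' m with frontier-step y s | frontier y c' ≤? frontier y c
  frontier-follows y {c} {c'} s ht ht' u' (inj₁ refl) | (l1 , l2) | yes q =
    leg y (frontier y c) , inj₁ refl , far-beyond-frontier y c' _ ht q , leg-adjacent y _ _ ht ht' adj , far-beyond-frontier y c' _ ht' ≤-refl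
    where
    adj : (frontier y c' ≡ frontier y c) ⊎ (frontier y c' ≡ suc (frontier y c)) ⊎ (frontier y c ≡ suc (frontier y c'))
    adj with frontier y c ≤? frontier y c'
    ... | yes q' = inj₁ (≤-antisym q q')
    ... | no q' = inj₂ (inj₂ (≤-antisym l2 (≰⇒> q')))
  frontier-follows y {c} {c'} s ht ht' u' (inj₂ refl) | (l1 , l2) | yes q with frontier y c ≤? frontier y c'
  ... | yes q' = leg y (suc (frontier y c) ⊓ l) , inj₂ refl , far-beyond-frontier y c' _ (suc⊓l≤l _) (≤-trans q (≤suc⊓l _ ht)) , subst (λ z → Stp (leg y (suc (frontier y c) ⊓ l)) (leg y (suc z ⊓ l))) (≤-antisym q' q) (inj₁ refl) , far-beyond-frontier y c' _ (suc⊓l≤l _) (≤suc⊓l _ ht')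
  ... | no q' = leg y (frontier y c) , inj₁ refl , far-beyond-frontier y c' _ ht q , subst (λ z → Stp (leg y (frontier y c)) (leg y z)) (sym mm) (inj₁ refl) , far-beyond-frontier y c' _ (suc⊓l≤l _) (≤suc⊓l _ ht')
    where
    e1 : frontier y c ≡ suc (frontier y c')
    e1 = ≤-antisym l2 (≰⇒> q')
    mm : suc (frontier y c') ⊓ l ≡ frontier y c
    mm = trans (m≤n⇒m⊓n≡m (subst (_≤ l) e1 ht)) (sym e1)
  frontier-follows y {c} {c'} s ht ht' u' (inj₁ refl) | (l1 , l2) | no q =
    leg y (suc (frontier y c) ⊓ l) , inj₂ refl , far-beyond-frontier y c' _ (suc⊓l≤l _) (subst (frontier y c' ≤_) (sym mm) ≤-refl) , subst (λ z → Stp (leg y z) (leg y (frontier y c'))) (sym mm) (inj₁ refl) , far-beyond-frontier y c' _ ht' ≤-refl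
    where
    e1 : frontier y c' ≡ suc (frontier y c)
    e1 = ≤-antisym l1 (≰⇒> q)
    mm : suc (frontier y c) ⊓ l ≡ frontier y c'
    mm = trans (m≤n⇒m⊓n≡m (subst (_≤ l) e1 ht')) (sym e1)
  frontier-follows y {c} {c'} s ht ht' u' (inj₂ refl) | (l1 , l2) | no q =
    leg y (suc (frontier y c) ⊓ l) , inj₂ refl , far-beyond-frontier y c' _ (suc⊓l≤l _) (subst (frontier y c' ≤_) (sym mm) ≤-refl) , subst (λ z → Stp (leg y z) (leg y (suc (frontier y c') ⊓ l))) (sym mm) (leg-adjacent y _ _ ht' (suc⊓l≤l _) adj) , far-beyond-frontier y c' _ (suc⊓l≤l _) (≤suc⊓l _ ht')
    where
    e1 : frontier y c' ≡ suc (frontier y c)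
    e1 = ≤-antisym l1 (≰⇒> q)
    mm : suc (frontier y c) ⊓ l ≡ frontier y c'
    mm = trans (m≤n⇒m⊓n≡m (subst (_≤ l) e1 ht')) (sym e1)
    adj : (suc (frontier y c') ⊓ l ≡ frontier y c') ⊎ (suc (frontier y c') ⊓ l ≡ suc (frontier y c')) ⊎ (frontier y c' ≡ suc (suc (frontier y c') ⊓ l))
    adj with suc⊓l-cases (frontier y c') ht'
    ... | inj₁ x = inj₂ (inj₁ x)
    ... | inj₂ x = inj₁ x

  -- twoLegs y d: the cop is within depth θ on legs y and ahead y d, and a robber waits at the frontier of each.
  -- dashWithLeg y d s, dash y d s: the cop has gone deeper than θ into leg behind y d, a robber runs along the cycle
  -- from hub y towards hub (ahead y d) and has done s steps; in dashWithLeg a robber also stays ahead of the cop in his leg.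
  data Mode : Set where
    twoLegs : Fin 3 → Dir → Mode
    dashWithLeg : Fin 3 → Dir → ℕ → Mode
    dash : Fin 3 → Dir → ℕ → Mode

  Valid : V → Mode → Set
  Valid c (twoLegs y d) = (legDepth y c ≤ θ) × (legDepth (ahead y d) c ≤ θ)
  Valid c (dashWithLeg y d s) = (c ≡ leg (behind y d) (suc (θ + s))) × (suc s ≤ k) × (suc (θ + s) + (ρ + 1) ≤ l)
  Valid c (dash y d s) = Σ ℕ λ e → (c ≡ leg (behind y d) e) × (suc s ≤ k) × (ρ + 1 ≤ e + s) × (e ≤ l)

  Hides : V → Mode → V → Set
  Hides c (twoLegs y d) u = AtFrontier y c u ⊎ AtFrontier (ahead y d) c u
  Hides c (dashWithLeg y d s) u = AtFrontier y c u ⊎ OnArc y d s u ⊎ AtFrontier (behind y d) c u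
  Hides c (dash y d s) u = AtFrontier y c u ⊎ OnArc y d s u

  far-frontier : ∀ y c u → frontier y c ≤ l → AtFrontier y c u → Far c u
  far-frontier y c u h (inj₁ refl) = far-beyond-frontier y c _ h ≤-refl
  far-frontier y c u h (inj₂ refl) = far-beyond-frontier y c _ (suc⊓l≤l _) (≤suc⊓l _ h)

  legDepth-otherLeg≤θ : ∀ y x e → y ≢ x → legDepth y (leg x e) ≤ θ
  legDepth-otherLeg≤θ y x e h = subst (_≤ θ) (sym (legDepth-otherLeg y x e h)) z≤n

  frontier≤l-otherLeg : ∀ y x e → y ≢ x → frontier y (leg x e) ≤ l
  frontier≤l-otherLeg y x e h = frontier≤l y (leg x e) (legDepth-otherLeg≤θ y x e h)

  ≢behind : ∀ y d → y ≢ behind y d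
  ≢behind y d = ≢-sym (behind≢ y d)

  hides-far : ∀ c st → Valid c st → ∀ u → Hides c st u → Far c u
  hides-far c (twoLegs y d) (h1 , h2) u (inj₁ m) = far-frontier y c u (frontier≤l y c h1) m
  hides-far c (twoLegs y d) (h1 , h2) u (inj₂ m) = far-frontier (ahead y d) c u (frontier≤l (ahead y d) c h2) m
  hides-far .(leg (behind y d) (suc (θ + s))) (dashWithLeg y d s) (refl , hs , hl) u (inj₁ m) = far-frontier y _ u (frontier≤l-otherLeg y (behind y d) (suc (θ + s)) (≢behind y d)) m
  hides-far .(leg (behind y d) (suc (θ + s))) (dashWithLeg y d s) (refl , hs , hl) u (inj₂ (inj₁ (inj₁ refl))) =
    far-arc y d s _ (≤-trans (n≤1+n s) hs) (s≤s z≤n) (≤-trans (m≤m+n _ (ρ + 1)) hl) (θ≤e⇒ρ+1≤e+k _ (≤-trans (m≤m+n θ s) (n≤1+n _)))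
  hides-far .(leg (behind y d) (suc (θ + s))) (dashWithLeg y d s) (refl , hs , hl) u (inj₂ (inj₁ (inj₂ refl))) =
    far-arc y d (suc s) _ hs (s≤s z≤n) (≤-trans (m≤m+n _ (ρ + 1)) hl) (θ≤e⇒ρ+1≤e+k _ (≤-trans (m≤m+n θ s) (n≤1+n _)))
  hides-far .(leg (behind y d) (suc (θ + s))) (dashWithLeg y d s) (refl , hs , hl) u (inj₂ (inj₂ m)) =
    far-frontier (behind y d) _ u (subst (_≤ l) (sym (frontier-ownLeg (behind y d) _ (≤-trans (m≤m+n _ (ρ + 1)) hl))) hl) m
  hides-far .(leg (behind y d) e) (dash y d s) (e , refl , hs , h1 , he) u (inj₁ m) = far-frontier y _ u (frontier≤l-otherLeg y (behind y d) e (≢behind y d)) m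
  hides-far .(leg (behind y d) e) (dash y d s) (e , refl , hs , h1 , he) u (inj₂ (inj₁ refl)) =
    far-arc y d s e (≤-trans (n≤1+n s) hs) e1 he (θ≤e⇒ρ+1≤e+k e θe)
    where
    θe : θ ≤ e
    θe = dash-depth e e s (n≤1+n e) h1 hs
    e1 : 1 ≤ e
    e1 = ≤-trans 1≤θ θe
  hides-far .(leg (behind y d) e) (dash y d s) (e , refl , hs , h1 , he) u (inj₂ (inj₂ refl)) =
    far-arc y d (suc s) e hs e1 he (θ≤e⇒ρ+1≤e+k e θe)
    where
    θe : θ ≤ e
    θe = dash-depth e e s (n≤1+n e) h1 hs
    e1 : 1 ≤ e
    e1 = ≤-trans 1≤θ θe

  hides-some : ∀ c st → Valid c st → Σ V (Hides c st)
  hides-some c (twoLegs y d) v = _ , inj₁ (inj₁ refl)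
  hides-some c (dashWithLeg y d s) v = _ , inj₁ (inj₁ refl)
  hides-some c (dash y d s) v = _ , inj₁ (inj₁ refl)

  start : ∀ c → Σ Mode (Valid c)
  start (inj₁ a) = twoLegs fz fwd , z≤n , z≤n
  start (inj₂ (fz , j)) = twoLegs (fs fz) fwd , z≤n , z≤n
  start (inj₂ (fs fz , j)) = twoLegs (fs (fs fz)) fwd , z≤n , z≤n
  start (inj₂ (fs (fs fz) , j)) = twoLegs fz fwd , z≤n , z≤n

  Responds : V → V → Mode → Mode → Set
  Responds c c' st st' = MovesInto c' (Hides c st) (Hides c' st')

  θ≤l : θ ≤ l
  θ≤l = ≤-trans (m≤m+n θ (ρ + 1)) θ+ρ+1≤l

  ρ+1≤θ+k : ρ + 1 ≤ θ + k
  ρ+1≤θ+k = ≤-reflexive (sym θ+k≡ρ+1)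

  leg-interior-moves′ : ∀ x e c' → 1 ≤ e → e ≤ l → Stp (leg x e) c' → Σ ℕ λ e' → (c' ≡ leg x e') × (e' ≤ l) × (e ≤ suc e')
  leg-interior-moves′ x e c' h1 h2 s with leg-interior-moves x e c' h1 h2 s
  ... | inj₁ eq = e , eq , h2 , n≤1+n e
  leg-interior-moves′ x (suc e₀) c' h1 h2 s | inj₂ (inj₁ eq) = e₀ , eq , ≤-trans (n≤1+n e₀) h2 , ≤-refl
  ... | inj₂ (inj₂ (h , eq)) = suc e , eq , h , ≤-trans (n≤1+n e) (n≤1+n _)

  arc-advance : ∀ y d s e' → suc (suc s) ≤ k → 1 ≤ e' → e' ≤ l → ρ + 1 ≤ e' + k → 
                MovesInto (leg (behind y d) e') (OnArc y d s) (OnArc y d (suc s))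
  arc-advance y d s e' h h1 h2 h3 u' (inj₁ refl) = cycV (arc y d (suc s)) , inj₂ refl , F (suc s) (<⇒≤ h) , inj₁ refl , F (suc s) (<⇒≤ h)
    where
    F : ∀ j → j ≤ k → Far (leg (behind y d) e') (cycV (arc y d j))
    F j hj = far-arc y d j e' hj h1 h2 h3
  arc-advance y d s e' h h1 h2 h3 u' (inj₂ refl) = cycV (arc y d (suc s)) , inj₂ refl , F (suc s) (<⇒≤ h) , arc-step y d (suc s) h , F (suc (suc s)) h
    where
    F : ∀ j → j ≤ k → Far (leg (behind y d) e') (cycV (arc y d j))
    F j hj = far-arc y d j e' hj h1 h2 h3

  arc-retreat : ∀ y d s e' → suc (suc s) ≤ k → 1 ≤ e' → e' ≤ l → ρ + 1 ≤ e' + k → 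
                MovesInto (leg (behind y d) e') (OnArc y d (suc s)) (OnArc y d s)
  arc-retreat y d s e' h h1 h2 h3 u' (inj₁ refl) = cycV (arc y d (suc s)) , inj₁ refl , F (suc s) (<⇒≤ h) , Step-sym (arc-step y d s (<⇒≤ h)) , F s (≤-trans (n≤1+n s) (<⇒≤ h))
    where
    F : ∀ j → j ≤ k → Far (leg (behind y d) e') (cycV (arc y d j))
    F j hj = far-arc y d j e' hj h1 h2 h3
  arc-retreat y d s e' h h1 h2 h3 u' (inj₂ refl) = cycV (arc y d (suc s)) , inj₁ refl , F (suc s) (<⇒≤ h) , inj₁ refl , F (suc s) (<⇒≤ h)
    where
    F : ∀ j → j ≤ k → Far (leg (behind y d) e') (cycV (arc y d j))
    F j hj = far-arc y d j e' hj h1 h2 h3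

  arc-arrive : ∀ y d s e' → suc s ≡ k → 1 ≤ e' → e' ≤ l → ρ + 1 ≤ e' + k → 
               MovesInto (leg (behind y d) e') (OnArc y d s) (AtFrontier (ahead y d) (leg (behind y d) e'))
  arc-arrive y d s e' hk h1 h2 h3 u' m = cycV (arc y d (suc s)) , inj₂ refl , F , st m , far-frontier z c' u' (frontier≤l-otherLeg z x e' (ahead≢behind y d)) m
    where
    x = behind y d
    z = ahead y d
    c' = leg x e'
    F : Far c' (cycV (arc y d (suc s)))
    F = far-arc y d (suc s) e' (≤-reflexive hk) h1 h2 h3
    ez : cycV (arc y d (suc s)) ≡ leg z 0
    ez = cong cycV (trans (cong (arc y d) hk) (arc-k y d))
    tz : frontier z c' ≡ 0
    tz = frontier-otherLeg≡0 z x e' (ahead≢behind y d) h2 h3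
    st : AtFrontier z c' u' → Stp (cycV (arc y d (suc s))) u'
    st (inj₁ refl) = subst (λ w → Stp w (leg z (frontier z c'))) (sym ez) (subst (λ t → Stp (leg z 0) (leg z t)) (sym tz) (inj₁ refl))
    st (inj₂ refl) = subst (λ w → Stp w (leg z (suc (frontier z c') ⊓ l))) (sym ez) (subst (λ t → Stp (leg z 0) (leg z (suc t ⊓ l))) (sym tz) (leg-step z 0 (s≤s z≤n)))

  arc-launch : ∀ o dd → let w = behind o dd in MovesInto (leg w (suc θ)) (AtFrontier o (leg w θ)) (OnArc o dd 0)
  arc-launch o dd u' m = leg o 0 , inj₁ (cong (leg o) (sym t0)) , F0 , st m , fr m
    where
    w = behind o dd
    t0 : frontier o (leg w θ) ≡ 0
    t0 = frontier-otherLeg≡0 o w θ (≢behind o dd) θ≤l ρ+1≤θ+k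
    θ<l : suc θ ≤ l
    θ<l = ≤-trans (s≤s (m≤m+n θ ρ)) (≤-trans (≤-reflexive (sym (+-suc θ ρ))) (subst (λ z → θ + z ≤ l) (+-comm ρ 1) θ+ρ+1≤l))
    t1 : frontier o (leg w (suc θ)) ≡ 0
    t1 = frontier-otherLeg≡0 o w (suc θ) (≢behind o dd) θ<l (≤-trans ρ+1≤θ+k (n≤1+n _))
    F0 : Far (leg w (suc θ)) (leg o 0)
    F0 = far-beyond-frontier o _ 0 z≤n (≤-reflexive t1)
    e0 : cycV (arc o dd 0) ≡ leg o 0
    e0 = cong cycV (arc-0 o dd)
    st : OnArc o dd 0 u' → Stp (leg o 0) u'
    st (inj₁ refl) = subst (Stp (leg o 0)) (sym e0) (inj₁ refl)
    st (inj₂ refl) = subst (λ z → Stp (cycV z) (cycV (arc o dd 1))) (arc-0 o dd) (arc-step o dd 0 (s≤s z≤n))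
    fr : OnArc o dd 0 u' → Far (leg w (suc θ)) u'
    fr (inj₁ refl) = subst (Far (leg w (suc θ))) (sym e0) F0
    fr (inj₂ refl) = far-arc o dd 1 (suc θ) (s≤s z≤n) (s≤s z≤n) θ<l (≤-trans ρ+1≤θ+k (n≤1+n _))

  stay : ∀ c st → Valid c st → Responds c c st st
  stay c st v u' m = u' , m , hides-far c st v u' m , inj₁ refl , hides-far c st v u' m

  θ<l : suc θ ≤ l
  θ<l = ≤-trans (s≤s (m≤m+n θ ρ)) (≤-trans (≤-reflexive (sym (+-suc θ ρ))) (subst (λ z → θ + z ≤ l) (+-comm ρ 1) θ+ρ+1≤l))

  cross-at-θ : ∀ o dd → let w = behind o dd in Stp (leg w θ) (leg w (suc θ)) →
    Σ Mode λ st' → Valid (leg w (suc θ)) st' ×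
      MovesInto (leg w (suc θ)) (λ u → AtFrontier o (leg w θ) u ⊎ AtFrontier w (leg w θ) u) (Hides (leg w (suc θ)) st')
  cross-at-θ o dd s with suc θ + (ρ + 1) ≤? l
  ... | yes q = dashWithLeg o dd 0 , (cong (λ z → leg (behind o dd) (suc z)) (sym (+-identityʳ θ)) , s≤s z≤n , subst (λ z → suc z + (ρ + 1) ≤ l) (sym (+-identityʳ θ)) q) , moves
    where
    w = behind o dd
    moves : MovesInto (leg w (suc θ)) (λ u → AtFrontier o (leg w θ) u ⊎ AtFrontier w (leg w θ) u) (Hides (leg w (suc θ)) (dashWithLeg o dd 0))
    moves u' (inj₁ m) = MovesInto-map inj₁ (frontier-follows o s (frontier≤l-otherLeg o w θ (≢behind o dd)) (frontier≤l-otherLeg o w (suc θ) (≢behind o dd))) u' m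
    moves u' (inj₂ (inj₁ t)) = MovesInto-map inj₁ (arc-launch o dd) u' t
    moves u' (inj₂ (inj₂ m)) = MovesInto-map inj₂ (frontier-follows w s (subst (_≤ l) (sym (frontier-ownLeg w θ θ≤l)) θ+ρ+1≤l) (subst (_≤ l) (sym (frontier-ownLeg w (suc θ) θ<l)) q)) u' m
  ... | no q = dash o dd 0 , (suc θ , refl , s≤s z≤n , dash-start θ 0 (+-identityʳ θ) q , θ<l) , moves
    where
    w = behind o dd
    moves : MovesInto (leg w (suc θ)) (λ u → AtFrontier o (leg w θ) u ⊎ AtFrontier w (leg w θ) u) (Hides (leg w (suc θ)) (dash o dd 0))
    moves u' (inj₁ m) = MovesInto-map inj₁ (frontier-follows o s (frontier≤l-otherLeg o w θ (≢behind o dd)) (frontier≤l-otherLeg o w (suc θ) (≢behind o dd))) u' m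
    moves u' (inj₂ t) = MovesInto-map inj₁ (arc-launch o dd) u' t

  cross-depths : ∀ a' p a → suc θ ≤ a' → a ≤ θ → a' + p ≤ suc (a + 0) → (a' ≡ suc θ) × (a ≡ θ)
  cross-depths a' p a h1 h2 h3 = ≤-antisym a'≤θ+1 h1 , ≤-antisym h2 (≤-pred (≤-trans h1 a'≤a+1))
    where
    a'≤a+1 : a' ≤ suc a
    a'≤a+1 = ≤-trans (m≤m+n a' p) (≤-trans h3 (≤-reflexive (cong suc (+-identityʳ a))))
    a'≤θ+1 : a' ≤ suc θ
    a'≤θ+1 = ≤-trans a'≤a+1 (s≤s h2)

  cross-into-leg : ∀ o dd {c c'} → Stp c c' → legDepth (behind o dd) c ≤ θ → legDepth o c ≤ θ → ¬ (legDepth (behind o dd) c' ≤ θ) →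
    Σ Mode λ st' → Valid c' st' × MovesInto c' (λ u → AtFrontier o c u ⊎ AtFrontier (behind o dd) c u) (Hides c' st')
  cross-into-leg o dd {c} {c'} s hw ho q with legDepth-pos (behind o dd) c' (≤-trans (s≤s z≤n) (≰⇒> q))
  ... | ec' , hl' with cross-depths (legDepth (behind o dd) c') (hubDist (behind o dd) c) (legDepth (behind o dd) c) (≰⇒> q) hw (subst (λ z → legDepth (behind o dd) c' + hubDist (behind o dd) c ≤ suc (legDepth (behind o dd) c + z)) (trans (cong (hubDist (behind o dd)) ec') (hubDist-leg (behind o dd) (legDepth (behind o dd) c'))) (potential-step (behind o dd) s))
  ... | e1 , e2 with legDepth-pos (behind o dd) c (subst (1 ≤_) (sym e2) 1≤θ)
  ... | ec , _ with trans ec (cong (leg (behind o dd)) e2) | trans ec' (cong (leg (behind o dd)) e1)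
  ... | refl | refl = cross-at-θ o dd s

  frontier≤l-ownLeg : ∀ x e → e + (ρ + 1) ≤ l → frontier x (leg x e) ≤ l
  frontier≤l-ownLeg x e h = subst (_≤ l) (sym (frontier-ownLeg x e (≤-trans (m≤m+n e (ρ + 1)) h))) h

  chase-up : ∀ y d sI {c'} → suc sI ≤ k → suc (θ + sI) + (ρ + 1) ≤ l → Stp (leg (behind y d) (suc (θ + sI))) c' → c' ≡ leg (behind y d) (θ + sI) →
         Σ Mode λ st' → Valid c' st' × Responds (leg (behind y d) (suc (θ + sI))) c' (dashWithLeg y d sI) st'
  chase-up y d zero hs hl s refl = twoLegs y (flip d) , (legDepth-otherLeg≤θ y x (θ + 0) (≢behind y d) , subst (_≤ θ) (sym (legDepth-leg x (θ + 0) h0)) (≤-reflexive (+-identityʳ θ))) , moves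
    where
    x = behind y d
    h0 : θ + 0 ≤ l
    h0 = subst (_≤ l) (sym (+-identityʳ θ)) θ≤l
    moves : Responds (leg x (suc (θ + 0))) (leg x (θ + 0)) (dashWithLeg y d 0) (twoLegs y (flip d))
    moves u' (inj₁ m) = MovesInto-map inj₁ (frontier-follows y s (frontier≤l-otherLeg y x (suc (θ + 0)) (≢behind y d)) (frontier≤l-otherLeg y x (θ + 0) (≢behind y d))) u' m
    moves u' (inj₂ m) = MovesInto-map (λ z → inj₂ (inj₂ z)) (frontier-follows x s (frontier≤l-ownLeg x (suc (θ + 0)) hl) (frontier≤l-ownLeg x (θ + 0) (subst (λ z → z + (ρ + 1) ≤ l) (sym (+-identityʳ θ)) θ+ρ+1≤l))) u' m
  chase-up y d (suc s₀) {c'} hs hl s ec' with trans ec' (cong (leg (behind y d)) (+-suc θ s₀))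
  ... | refl = dashWithLeg y d s₀ , (refl , <⇒≤ hs , hl'') , moves
    where
    x = behind y d
    hl'' : suc (θ + s₀) + (ρ + 1) ≤ l
    hl'' = ≤-trans (+-monoˡ-≤ (ρ + 1) (s≤s (+-monoʳ-≤ θ (n≤1+n s₀)))) hl
    e'l : suc (θ + s₀) ≤ l
    e'l = ≤-trans (m≤m+n _ (ρ + 1)) hl''
    moves : Responds (leg x (suc (θ + suc s₀))) (leg x (suc (θ + s₀))) (dashWithLeg y d (suc s₀)) (dashWithLeg y d s₀)
    moves u' (inj₁ m) = MovesInto-map inj₁ (frontier-follows y s (frontier≤l-otherLeg y x (suc (θ + suc s₀)) (≢behind y d)) (frontier≤l-otherLeg y x (suc (θ + s₀)) (≢behind y d))) u' m
    moves u' (inj₂ (inj₁ t)) = MovesInto-map (λ z → inj₂ (inj₁ z)) (arc-retreat y d s₀ (suc (θ + s₀)) hs (s≤s z≤n) e'l (θ≤e⇒ρ+1≤e+k _ (≤-trans (m≤m+n θ s₀) (n≤1+n _)))) u' t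
    moves u' (inj₂ (inj₂ m)) = MovesInto-map (λ z → inj₂ (inj₂ z)) (frontier-follows x s (frontier≤l-ownLeg x (suc (θ + suc s₀)) hl) (frontier≤l-ownLeg x (suc (θ + s₀)) hl'')) u' m

  chase-down : ∀ y d sI {c'} → suc sI ≤ k → suc (θ + sI) + (ρ + 1) ≤ l → Stp (leg (behind y d) (suc (θ + sI))) c' →
           suc (suc (θ + sI)) ≤ l → c' ≡ leg (behind y d) (suc (suc (θ + sI))) →
           Σ Mode λ st' → Valid c' st' × Responds (leg (behind y d) (suc (θ + sI))) c' (dashWithLeg y d sI) st'
  chase-down y d sI hs hl s hle refl with suc sI ≟ k
  ... | yes hk = twoLegs y d , (legDepth-otherLeg≤θ y x e' (≢behind y d) , legDepth-otherLeg≤θ (ahead y d) x e' (ahead≢behind y d)) , moves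
    where
    x = behind y d
    e' = suc (suc (θ + sI))
    θe : θ ≤ e'
    θe = ≤-trans (m≤m+n θ sI) (≤-trans (n≤1+n _) (n≤1+n _))
    moves : Responds (leg x (suc (θ + sI))) (leg x e') (dashWithLeg y d sI) (twoLegs y d)
    moves u' (inj₁ m) = MovesInto-map inj₁ (frontier-follows y s (frontier≤l-otherLeg y x (suc (θ + sI)) (≢behind y d)) (frontier≤l-otherLeg y x e' (≢behind y d))) u' m
    moves u' (inj₂ m) = MovesInto-map (λ z → inj₂ (inj₁ z)) (arc-arrive y d sI e' hk (s≤s z≤n) hle (θ≤e⇒ρ+1≤e+k e' θe)) u' m
  ... | no hk with suc (suc (θ + sI)) + (ρ + 1) ≤? l
  ...   | yes q = dashWithLeg y d (suc sI) , (cong (λ z → leg (behind y d) (suc z)) (sym (+-suc θ sI)) , ≤∧≢⇒< hs hk , subst (λ z → suc z + (ρ + 1) ≤ l) (sym (+-suc θ sI)) q) , moves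
    where
    x = behind y d
    e' = suc (suc (θ + sI))
    θe : θ ≤ e'
    θe = ≤-trans (m≤m+n θ sI) (≤-trans (n≤1+n _) (n≤1+n _))
    moves : Responds (leg x (suc (θ + sI))) (leg x e') (dashWithLeg y d sI) (dashWithLeg y d (suc sI))
    moves u' (inj₁ m) = MovesInto-map inj₁ (frontier-follows y s (frontier≤l-otherLeg y x (suc (θ + sI)) (≢behind y d)) (frontier≤l-otherLeg y x e' (≢behind y d))) u' m
    moves u' (inj₂ (inj₁ t)) = MovesInto-map (λ z → inj₂ (inj₁ z)) (arc-advance y d sI e' (≤∧≢⇒< hs hk) (s≤s z≤n) hle (θ≤e⇒ρ+1≤e+k e' θe)) u' t
    moves u' (inj₂ (inj₂ m)) = MovesInto-map (λ z → inj₂ (inj₂ z)) (frontier-follows x s (frontier≤l-ownLeg x (suc (θ + sI)) hl) (frontier≤l-ownLeg x e' q)) u' m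
  ...   | no q = dash y d (suc sI) , (suc (suc (θ + sI)) , refl , ≤∧≢⇒< hs hk , dash-start (suc (θ + sI)) (suc sI) (+-suc θ sI) q , hle) , moves
    where
    x = behind y d
    e' = suc (suc (θ + sI))
    θe : θ ≤ e'
    θe = ≤-trans (m≤m+n θ sI) (≤-trans (n≤1+n _) (n≤1+n _))
    moves : Responds (leg x (suc (θ + sI))) (leg x e') (dashWithLeg y d sI) (dash y d (suc sI))
    moves u' (inj₁ m) = MovesInto-map inj₁ (frontier-follows y s (frontier≤l-otherLeg y x (suc (θ + sI)) (≢behind y d)) (frontier≤l-otherLeg y x e' (≢behind y d))) u' m
    moves u' (inj₂ t) = MovesInto-map (λ z → inj₂ (inj₁ z)) (arc-advance y d sI e' (≤∧≢⇒< hs hk) (s≤s z≤n) hle (θ≤e⇒ρ+1≤e+k e' θe)) u' t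

  climb-move : ∀ y d sI e e' {c'} → suc sI ≤ k → ρ + 1 ≤ e + sI → e ≤ l → Stp (leg (behind y d) e) c' → c' ≡ leg (behind y d) e' → e' ≤ l → e ≤ suc e' →
           Σ Mode λ st' → Valid c' st' × Responds (leg (behind y d) e) c' (dash y d sI) st'
  climb-move y d sI e e' hs h1 he s refl he' hee with suc sI ≟ k
  ... | yes hk = twoLegs y d , (legDepth-otherLeg≤θ y x e' (≢behind y d) , legDepth-otherLeg≤θ (ahead y d) x e' (ahead≢behind y d)) , moves
    where
    x = behind y d
    θe' : θ ≤ e'
    θe' = dash-depth e e' sI hee h1 hs
    moves : Responds (leg x e) (leg x e') (dash y d sI) (twoLegs y d)
    moves u' (inj₁ m) = MovesInto-map inj₁ (frontier-follows y s (frontier≤l-otherLeg y x e (≢behind y d)) (frontier≤l-otherLeg y x e' (≢behind y d))) u' m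
    moves u' (inj₂ m) = MovesInto-map inj₂ (arc-arrive y d sI e' hk (≤-trans 1≤θ θe') he' (θ≤e⇒ρ+1≤e+k e' θe')) u' m
  ... | no hk = dash y d (suc sI) , (e' , refl , ≤∧≢⇒< hs hk , ≤-trans h1 (≤-trans (+-monoˡ-≤ sI hee) (≤-reflexive (sym (+-suc e' sI)))) , he') , moves
    where
    x = behind y d
    θe' : θ ≤ e'
    θe' = dash-depth e e' sI hee h1 hs
    moves : Responds (leg x e) (leg x e') (dash y d sI) (dash y d (suc sI))
    moves u' (inj₁ m) = MovesInto-map inj₁ (frontier-follows y s (frontier≤l-otherLeg y x e (≢behind y d)) (frontier≤l-otherLeg y x e' (≢behind y d))) u' m
    moves u' (inj₂ t) = MovesInto-map inj₂ (arc-advance y d sI e' (≤∧≢⇒< hs hk) (≤-trans 1≤θ θe') he' (θ≤e⇒ρ+1≤e+k e' θe')) u' t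

  respond : ∀ c c' → Stp c c' → ∀ st → Valid c st → Σ Mode λ st' → Valid c' st' × Responds c c' st st'
  respond c c' s (twoLegs y d) (h1 , h2) with legDepth y c' ≤? θ | legDepth (ahead y d) c' ≤? θ
  ... | yes q1 | yes q2 = twoLegs y d , (q1 , q2) , moves
    where
    moves : Responds c c' (twoLegs y d) (twoLegs y d)
    moves u' (inj₁ m) = MovesInto-map inj₁ (frontier-follows y s (frontier≤l y c h1) (frontier≤l y c' q1)) u' m
    moves u' (inj₂ m) = MovesInto-map inj₂ (frontier-follows (ahead y d) s (frontier≤l _ c h2) (frontier≤l _ c' q2)) u' m
  ... | no q1 | _ = proj₁ r , proj₁ (proj₂ r) , MovesInto-map fm (proj₂ (proj₂ r))
    where
    r = cross-into-leg (ahead y d) d s (subst (λ w → legDepth w c ≤ θ) (sym (behind-ahead y d)) h1) h2 (subst (λ w → ¬ (legDepth w c' ≤ θ)) (sym (behind-ahead y d)) q1)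
    fm : ∀ {u} → AtFrontier (ahead y d) c u ⊎ AtFrontier (behind (ahead y d) d) c u → Hides c (twoLegs y d) u
    fm (inj₁ m) = inj₂ m
    fm {u} (inj₂ m) = inj₁ (subst (λ w → AtFrontier w c u) (behind-ahead y d) m)
  ... | yes q1 | no q2 = proj₁ r , proj₁ (proj₂ r) , MovesInto-map fm (proj₂ (proj₂ r))
    where
    ee : behind y (flip d) ≡ ahead y d
    ee = cong (ahead y) (flip-flip d)
    r = cross-into-leg y (flip d) s (subst (λ w → legDepth w c ≤ θ) (sym ee) h2) h1 (subst (λ w → ¬ (legDepth w c' ≤ θ)) (sym ee) q2)
    fm : ∀ {u} → AtFrontier y c u ⊎ AtFrontier (behind y (flip d)) c u → Hides c (twoLegs y d) u
    fm (inj₁ m) = inj₁ m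
    fm {u} (inj₂ m) = inj₂ (subst (λ w → AtFrontier w c u) ee m)
  respond .(leg (behind y d) (suc (θ + sI))) c' s (dashWithLeg y d sI) (refl , hs , hl) with leg-interior-moves (behind y d) (suc (θ + sI)) c' (s≤s z≤n) (≤-trans (m≤m+n _ (ρ + 1)) hl) s
  ... | inj₁ refl = dashWithLeg y d sI , (refl , hs , hl) , stay _ (dashWithLeg y d sI) (refl , hs , hl)
  ... | inj₂ (inj₁ ec') = chase-up y d sI hs hl s ec'
  ... | inj₂ (inj₂ (hle , ec')) = chase-down y d sI hs hl s hle ec'
  respond .(leg (behind y d) e) c' s (dash y d sI) (e , refl , hs , h1 , he) with leg-interior-moves′ (behind y d) e c' (≤-trans 1≤θ (dash-depth e e sI (n≤1+n e) h1 hs)) he s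
  ... | e' , ec' , he' , hee = climb-move y d sI e e' hs h1 he s ec' he' hee

  ¬copWins : ¬ CopWins G ρ
  ¬copWins = strategy⇒¬CopWins (record { State = Mode ; Valid = Valid ; Hides = Hides ; start = start ; hides-far = hides-far ; hides-some = hides-some ; respond = respond })

module Patrol (k' l' ρ : ℕ) (short-cycle : 3 * suc k' ≤ 2 * ρ + 2) (short-legs : 2 * suc l' + suc k' ≤ 4 * ρ + 2) where
  open Tkl k' l'
  open Concatenation G ρ
  open RobberGame G ρ

  k≤ρ : k ≤ ρ
  k≤ρ = 3k≤2ρ+2⇒k≤ρ k ρ short-cycle

  d : ℕ
  d = l ∸ ρ

  d≤l : d ≤ l
  d≤l = m∸n≤m l ρ

  l≤d+ρ : l ≤ d + ρ
  l≤d+ρ = subst (l ≤_) (+-comm ρ d) (m≤n+m∸n l ρ)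

  d≤ρ : d ≤ ρ
  d≤ρ = m≤n+o⇒m∸n≤o l ρ l≤ρ+ρ
    where
    l≤ρ+ρ : l ≤ ρ + ρ
    l≤ρ+ρ with l ≤? ρ + ρ
    ... | yes h = h
    ... | no h = ⊥-elim (<⇒≱ (≤-trans (m<m+n (2 * l) (s≤s z≤n)) short-legs) (≤-trans (≤-reflexive (eq ρ)) (*-monoʳ-≤ 2 (≰⇒> h))))
      where
      eq : ∀ ρ → 4 * ρ + 2 ≡ 2 * suc (ρ + ρ)
      eq ρ = solve (ρ ∷ [])

  2d+k≤2ρ+2 : 2 * d + k ≤ 2 * ρ + 2
  2d+k≤2ρ+2 with ρ ≤? l
  ... | yes ρ≤l = ≤-balance (2 * d + k) (2 * ρ + 2) 0 short-legs (eq d ρ k (m∸n+n≡m ρ≤l))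
    where
    eq : ∀ d ρ k {l} → d + ρ ≡ l → 2 * ρ + 2 + (2 * l + k) ≡ 2 * d + k + 0 + (4 * ρ + 2)
    eq d ρ k refl = solve (d ∷ ρ ∷ k ∷ [])
  ... | no ρ≰l = subst (λ w → 2 * w + k ≤ 2 * ρ + 2) (sym (m≤n⇒m∸n≡0 (<⇒≤ (≰⇒> ρ≰l)))) (≤-trans (m≤n*m k 3) short-cycle)

  near-on-leg : ∀ y a b → a ≤ l → b ≤ l → ∣ a - b ∣ ≤ ρ → Far (leg y a) (leg y b) → ⊥
  near-on-leg y a b ha hb h F = F (Reach-mono h (leg-reach y a b ha hb))

  far⇒cdist : ∀ b a → b < n → a < n → Far (cycV b) (cycV a) → ρ + 1 ≤ cdist b a
  far⇒cdist b a hb ha F with cdist b a ≤? ρ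
  ... | yes h = ⊥-elim (F (Reach-mono h (cycV-reach-cdist b a hb ha)))
  ... | no h = subst (_≤ cdist b a) (+-comm 1 ρ) (≰⇒> h)

  pushed-deeper : ∀ s D D' → ρ + 1 + s ≤ D → D ≤ suc D' → suc s ≤ ρ → 1 ≤ D'
  pushed-deeper s D D' h1 h2 h3 = ≤-balance 1 D' (s + s) (+-mono-≤ (+-mono-≤ h1 h2) h3) (eq ρ s D D')
    where
    eq : ∀ ρ s D D' → D' + (ρ + 1 + s + D + suc s) ≡ 1 + (s + s) + (D + suc D' + ρ)
    eq ρ s D D' = solve (ρ ∷ s ∷ D ∷ D' ∷ [])

  stays-ahead : ∀ s D' → ¬ (ρ + 1 + suc s ≤ D') → D' ≤ suc s + ρ
  stays-ahead s D' q = ≤-pred (subst (suc D' ≤_) (eq ρ s) (≰⇒> q))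
    where
    eq : ∀ ρ s → ρ + 1 + suc s ≡ suc (suc s + ρ)
    eq ρ s = solve (ρ ∷ s ∷ [])

  leg₁-too-short : ∀ s w → d ≡ suc s + w → ρ + 1 ≤ 0 + (d + s) → ρ + 1 ≤ w + k → ⊥
  leg₁-too-short s w e h1 h2 = 1+n≰n (≤-balance 1 0 0 (+-mono-≤ (+-mono-≤ (subst (λ z → ρ + 1 ≤ 0 + (z + s)) e h1) h2) (subst (λ z → 2 * z + k ≤ 2 * ρ + 2) e 2d+k≤2ρ+2)) (eq ρ k s w))
    where
    eq : ∀ ρ k s w → 0 + (ρ + 1 + (ρ + 1) + (2 * (suc s + w) + k)) ≡ 1 + 0 + (0 + (suc s + w + s) + (w + k) + (2 * ρ + 2))
    eq ρ k s w = solve (ρ ∷ k ∷ s ∷ w ∷ [])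

  push-along-leg : ∀ y s {u u'} → suc s ≤ ρ → suc s ≤ l → ρ + 1 + s ≤ legDepth y u → Stp u u' → Far (leg y (suc s)) u' → ρ + 1 + suc s ≤ legDepth y u'
  push-along-leg y s {u} {u'} hs hsl h st F with legDepth-pos y u' (pushed-deeper s (legDepth y u) (legDepth y u') h (legDepth-step y st (≤-trans (≤-trans (m≤n+m 1 ρ) (m≤m+n (ρ + 1) s)) h)) hs)
  ... | eu' , hl' with (ρ + 1 + suc s) ≤? legDepth y u'
  ...   | yes q = q
  ...   | no q = ⊥-elim (near-on-leg y (suc s) (legDepth y u') hsl hl' (∣-∣≤ _ _ ρ (≤-trans hs (m≤n+m ρ _)) (stays-ahead s _ q)) (subst (Far (leg y (suc s))) eu' F))

  beyond-leg-end : ∀ X → ρ + 1 + d ≤ X → X ≤ l → ⊥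
  beyond-leg-end X h1 h2 = 1+n≰n (≤-trans (≤-reflexive (eq ρ d)) (≤-trans h1 (≤-trans h2 (≤-trans l≤d+ρ (≤-reflexive (+-comm d ρ))))))
    where
    eq : ∀ ρ d → suc (ρ + d) ≡ ρ + 1 + d
    eq ρ d = solve (ρ ∷ d ∷ [])



  descend₀ arc₀₁ climb₁ descend₁ arc₁₂ climb₂ : ℕ → V
  descend₀ s = leg fz (d ∸ s)
  arc₀₁ s = cycV s
  climb₁ s = leg (fs fz) s
  descend₁ s = leg (fs fz) (d ∸ s)
  arc₁₂ s = cycV (k + s)
  climb₂ s = leg (fs (fs fz)) s

  descend₀-off-leg₀ : ∀ r → Escapes G ρ d descend₀ r → ∀ s → s ≤ d → legDepth fz (r s) ≡ 0
  descend₀-off-leg₀ r (w , f1 , f2) zero _ with 1 ≤? legDepth fz (r 0)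
  ... | no q = n<1⇒n≡0 (≰⇒> q)
  ... | yes q with legDepth-pos fz (r 0) q
  ...   | e , hl = ⊥-elim (near-on-leg fz d (legDepth fz (r 0)) d≤l hl (∣-∣≤ d _ ρ (≤-trans d≤ρ (m≤n+m ρ _)) (≤-trans hl l≤d+ρ)) (subst (Far (leg fz d)) e (f1 0 z≤n)))
  descend₀-off-leg₀ r (w , f1 , f2) (suc s) h with 1 ≤? legDepth fz (r (suc s))
  ... | no q = n<1⇒n≡0 (≰⇒> q)
  ... | yes q = ⊥-elim (near-on-leg fz (d ∸ suc s) 0 (≤-trans (m∸n≤m d (suc s)) d≤l) z≤n (subst (_≤ ρ) (sym (∣-∣-identityʳ _)) (≤-trans (m∸n≤m d (suc s)) d≤ρ)) (subst (Far (leg fz (d ∸ suc s))) (enters-leg-from-hub fz (w s h) (descend₀-off-leg₀ r (w , f1 , f2) s (≤-trans (n≤1+n s) h)) q) (f2 s h)))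

  InLeg₁or₂ : V → Set
  InLeg₁or₂ u = Σ (Fin 3) λ i → Σ (Fin l) λ j → (u ≡ inj₂ (i , j)) × (i ≢ fz)

  k<n : k < n
  k<n = k<3k k'

  arc₀₁-into-legs₁₂ : ∀ r → Escapes G ρ k arc₀₁ r → legDepth fz (r 0) ≡ 0 → InLeg₁or₂ (r k)
  arc₀₁-into-legs₁₂ r (w , f1 , f2) pre = fin
    where
    off-leg₀ : ∀ s → s ≤ k → legDepth fz (r s) ≡ 0
    off-leg₀ zero _ = pre
    off-leg₀ (suc s) h with 1 ≤? legDepth fz (r (suc s))
    ... | no q = n<1⇒n≡0 (≰⇒> q)
    ... | yes q = ⊥-elim (1+n≰n (≤-trans (≤-trans (≤-reflexive (+-comm 1 ρ)) (far⇒cdist (suc s) 0 (≤-<-trans h k<n) (s≤s z≤n) (subst (Far (cycV (suc s))) (enters-leg-from-hub fz (w s h) (off-leg₀ s (≤-trans (n≤1+n s) h)) q) (f2 s h)))) (≤-trans (cdist≤∣-∣ (suc s) 0) (≤-trans h k≤ρ))))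
    not-on-cycle : ∀ s → suc s ≤ k → (a : Fin n) → r s ≡ inj₁ a → ⊥
    not-on-cycle s h a e = no-common-antipode ρ short-cycle (toℕ a) s (toℕ<n a) (≤-<-trans h k<n)
      (subst (ρ + 1 ≤_) (cdist-sym s (toℕ a)) (far⇒cdist s (toℕ a) (≤-<-trans (≤-trans (n≤1+n s) h) k<n) (toℕ<n a) (subst (Far (cycV s)) (trans e (sym (cycV-toℕ a))) (f1 s (≤-trans (n≤1+n s) h)))))
      (subst (ρ + 1 ≤_) (cdist-sym (suc s) (toℕ a)) (far⇒cdist (suc s) (toℕ a) (≤-<-trans h k<n) (toℕ<n a) (subst (Far (cycV (suc s))) (trans e (sym (cycV-toℕ a))) (f2 s h))))
    fin : InLeg₁or₂ (r k)
    fin with r k' in ek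
    ... | inj₁ a = ⊥-elim (not-on-cycle k' ≤-refl a ek)
    ... | inj₂ (i , j) with leg-moves i j (r k) (subst (λ z → Stp z (r k)) ek (w k' ≤-refl))
    ...   | inj₁ e = i , j , e , ne
      where
      ne : i ≢ fz
      ne refl = 1+n≢0 (trans (sym (cong (legDepth fz) ek)) (off-leg₀ k' (n≤1+n k')))
    ...   | inj₂ (inj₁ (j' , e , _)) = i , j' , e , ne
      where
      ne : i ≢ fz
      ne refl = 1+n≢0 (trans (sym (cong (legDepth fz) ek)) (off-leg₀ k' (n≤1+n k')))
    ...   | inj₂ (inj₂ (inj₁ (j' , e , _))) = i , j' , e , ne
      where
      ne : i ≢ fz
      ne refl = 1+n≢0 (trans (sym (cong (legDepth fz) ek)) (off-leg₀ k' (n≤1+n k')))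
    ...   | inj₂ (inj₂ (inj₂ (e , _))) = ⊥-elim (1+n≰n (≤-trans (≤-trans (≤-reflexive (+-comm 1 ρ)) (far⇒cdist k (toℕ i * k) k<n (hub<n i) (subst (Far (cycV k)) e (f1 k ≤-refl)))) (≤-trans (≤-reflexive (trans (cong (λ z → cdist z (toℕ i * k)) (sym (*-identityˡ k))) (cdist-hubs (fs fz) i))) (≤-trans (ifSame-0≤ i (fs fz) k) k≤ρ))))

  OffLegs₀₁AndFar : V → Set
  OffLegs₀₁AndFar u = (legDepth fz u ≡ 0) × (legDepth (fs fz) u ≡ 0) × (ρ + 1 ≤ hubDist fz u + d)

  Climb₁Invariant : ℕ → V → Set
  Climb₁Invariant s u = (ρ + 1 + s ≤ legDepth (fs fz) u) ⊎ ((legDepth fz u ≡ 0) × (legDepth (fs fz) u ≡ 0) × (ρ + 1 ≤ hubDist fz u + s))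



  far-step : ∀ P s → ρ + 1 ≤ P + s → ∀ P' → P ≤ suc P' → ρ + 1 ≤ P' + suc s
  far-step P s h P' h' = ≤-trans h (≤-trans (+-monoˡ-≤ s h') (≤-reflexive (sym (+-suc P' s))))

  climb₁-clears-leg₁ : ∀ r → Escapes G ρ d climb₁ r → InLeg₁or₂ (r 0) → OffLegs₀₁AndFar (r d)
  climb₁-clears-leg₁ r (w , f1 , f2) (i , j , e0 , ne) = fin (inv d ≤-refl)
    where
    base : ∀ i j → r 0 ≡ inj₂ (i , j) → i ≢ fz → Climb₁Invariant 0 (r 0)
    base fz j e ne = ⊥-elim (ne refl)
    base (fs fz) j e ne with (ρ + 1 + 0) ≤? suc (toℕ j)
    ... | yes q = inj₁ (subst (λ z → ρ + 1 + 0 ≤ legDepth (fs fz) z) (sym e) q)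
    ... | no q = ⊥-elim (near-on-leg (fs fz) 0 (suc (toℕ j)) z≤n (toℕ<n j) (≤-pred (subst (suc (suc (toℕ j)) ≤_) (eqq ρ) (≰⇒> q))) (subst (Far (leg (fs fz) 0)) (trans e (inj₂≡leg (fs fz) j)) (f1 0 z≤n)))
      where
      eqq : ∀ ρ → ρ + 1 + 0 ≡ suc ρ
      eqq ρ = solve (ρ ∷ [])
    base (fs (fs fz)) j e ne = inj₂ (cong (legDepth fz) e , cong (legDepth (fs fz)) e , subst (λ z → ρ + 1 ≤ hubDist fz z + 0) (sym e) hh)
      where
      rr : Reach G (suc (toℕ j) + cdist (toℕ {3} (fs (fs fz)) * k) (toℕ {3} (fs fz) * k)) (leg (fs fz) 0) (leg (fs (fs fz)) (suc (toℕ j)))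
      rr = Reach-sym (leg-reach-hub (fs (fs fz)) (suc (toℕ j)) (fs fz) (toℕ<n j))
      hh : ρ + 1 ≤ suc (toℕ j) + k + 0
      hh with (ρ + 1) ≤? suc (toℕ j) + k + 0
      ... | yes q = q
      ... | no q = ⊥-elim (subst (Far (leg (fs fz) 0)) (trans e (inj₂≡leg _ j)) (f1 0 z≤n) (Reach-mono (≤-trans (≤-reflexive (trans (cong (suc (toℕ j) +_) (cdist-hubs (fs (fs fz)) (fs fz))) (sym (+-identityʳ _)))) (≤-pred (subst (suc (suc (toℕ j) + k + 0) ≤_) (+-comm ρ 1) (≰⇒> q)))) rr))
    inv : ∀ s → s ≤ d → Climb₁Invariant s (r s)
    inv zero _ = base i j e0 ne
    inv (suc s) h with inv s (≤-trans (n≤1+n s) h)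
    ... | inj₁ hh = inj₁ (push-along-leg (fs fz) s (≤-trans h d≤ρ) (≤-trans h d≤l) hh (w s h) (f1 (suc s) h))
    ... | inj₂ (e0' , e1' , hp) with 1 ≤? legDepth (fs fz) (r (suc s))
    ...   | yes q = ⊥-elim (near-on-leg (fs fz) (suc s) 0 (≤-trans h d≤l) z≤n (≤-trans h d≤ρ) (subst (Far (leg (fs fz) (suc s))) (enters-leg-from-hub (fs fz) (w s h) e1' q) (f2 s h)))
    ...   | no q1 with 1 ≤? legDepth fz (r (suc s))
    ...     | yes q = ⊥-elim (1+n≰n (≤-trans (≤-reflexive (+-comm 1 ρ)) (≤-trans (subst (λ z → ρ + 1 ≤ hubDist fz z + s) (enters-leg-from-hub fz (w s h) e0' q) hp) (≤-trans (≤-reflexive (cong (_+ s) (hubDist-leg fz 0))) (≤-trans (n≤1+n s) (≤-trans h d≤ρ))))))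
    ...     | no q0 = inj₂ (n<1⇒n≡0 (≰⇒> q0) , n<1⇒n≡0 (≰⇒> q1) , far-step _ s hp _ (hubDist-step fz (w s h) e0' (n<1⇒n≡0 (≰⇒> q0))))
    fin : Climb₁Invariant d (r d) → OffLegs₀₁AndFar (r d)
    fin (inj₁ hh) = ⊥-elim (beyond-leg-end _ hh (legDepth≤l (fs fz) (r d)))
    fin (inj₂ x) = x

  OffLegs₀₁ : V → Set
  OffLegs₀₁ u = (legDepth fz u ≡ 0) × (legDepth (fs fz) u ≡ 0)

  descend₁-keeps-off-legs₀₁ : ∀ r → Escapes G ρ d descend₁ r → OffLegs₀₁AndFar (r 0) → OffLegs₀₁ (r d)
  descend₁-keeps-off-legs₀₁ r (w , f1 , f2) (m0 , m1 , m2) = let x = inv d ≤-refl in proj₁ x , proj₁ (proj₂ x)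
    where
    inv : ∀ s → s ≤ d → (legDepth fz (r s) ≡ 0) × (legDepth (fs fz) (r s) ≡ 0) × (ρ + 1 ≤ hubDist fz (r s) + (d + s))
    inv zero _ = m0 , m1 , subst (λ z → ρ + 1 ≤ hubDist fz (r 0) + z) (sym (+-identityʳ d)) m2
    inv (suc s) h with inv s (≤-trans (n≤1+n s) h)
    ... | e0' , e1' , hp with 1 ≤? legDepth (fs fz) (r (suc s))
    ...   | yes q = ⊥-elim (near-on-leg (fs fz) (d ∸ suc s) 0 (≤-trans (m∸n≤m d (suc s)) d≤l) z≤n (subst (_≤ ρ) (sym (∣-∣-identityʳ _)) (≤-trans (m∸n≤m d (suc s)) d≤ρ)) (subst (Far (leg (fs fz) (d ∸ suc s))) (enters-leg-from-hub (fs fz) (w s h) e1' q) (f2 s h)))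
    ...   | no q1 with 1 ≤? legDepth fz (r (suc s))
    ...     | yes q = ⊥-elim (leg₁-too-short s (d ∸ suc s) (sym (m+[n∸m]≡n h)) (subst (λ z → ρ + 1 ≤ hubDist fz z + (d + s)) (enters-leg-from-hub fz (w s h) e0' q) hp) hk)
      where
      F : Far (leg (fs fz) (d ∸ suc s)) (hub fz)
      F = subst (Far (leg (fs fz) (d ∸ suc s))) (enters-leg-from-hub fz (w s h) e0' q) (f2 s h)
      hk : ρ + 1 ≤ (d ∸ suc s) + k
      hk with (ρ + 1) ≤? (d ∸ suc s) + k
      ... | yes qq = qq
      ... | no qq = ⊥-elim (F (Reach-mono (≤-trans (≤-reflexive (cong ((d ∸ suc s) +_) (cdist-hubs (fs fz) fz))) (≤-pred (subst (suc ((d ∸ suc s) + k) ≤_) (+-comm ρ 1) (≰⇒> qq)))) (leg-reach-hub (fs fz) (d ∸ suc s) fz (≤-trans (m∸n≤m d (suc s)) d≤l))))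
    ...     | no q0 = n<1⇒n≡0 (≰⇒> q0) , n<1⇒n≡0 (≰⇒> q1) , subst (λ z → ρ + 1 ≤ hubDist fz (r (suc s)) + z) (sym (+-suc d s)) (far-step _ (d + s) hp _ (hubDist-step fz (w s h) e0' (n<1⇒n≡0 (≰⇒> q0))))

  k+s<n : ∀ s → s ≤ k → k + s < n
  k+s<n s h = k+s<3k k' s h

  arc₁₂-ends-at-hub₂ : cycV (k + k) ≡ leg (fs (fs fz)) 0
  arc₁₂-ends-at-hub₂ = cong cycV (cong (k +_) (sym (+-identityʳ k)))

  arc₁₂-into-leg₂ : ∀ r → Escapes G ρ k arc₁₂ r → OffLegs₀₁ (r 0) → ρ + 1 ≤ legDepth (fs (fs fz)) (r k)
  arc₁₂-into-leg₂ r (w , f1 , f2) pre = fin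
    where
    far-now : ∀ s → s ≤ k → (a : ℕ) → a < n → r s ≡ cycV a → ρ + 1 ≤ cdist (k + s) a
    far-now s h a ha e = far⇒cdist (k + s) a (k+s<n s h) ha (subst (Far (cycV (k + s))) e (f1 s h))
    far-next : ∀ s → suc s ≤ k → (a : ℕ) → a < n → r s ≡ cycV a → ρ + 1 ≤ cdist (suc (k + s)) a
    far-next s h a ha e = subst (λ z → ρ + 1 ≤ cdist z a) (+-suc k s) (far⇒cdist (k + suc s) a (k+s<n (suc s) h) ha (subst (Far (cycV (k + suc s))) e (f2 s h)))
    off-cycle : ∀ s → suc s ≤ k → (a : ℕ) → a < n → r s ≡ cycV a → ⊥
    off-cycle s h a ha e = no-common-antipode ρ short-cycle a (k + s) ha (subst (_< n) (+-suc k s) (k+s<n (suc s) h))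
      (subst (ρ + 1 ≤_) (cdist-sym (k + s) a) (far-now s (≤-trans (n≤1+n s) h) a ha e))
      (subst (ρ + 1 ≤_) (cdist-sym (suc (k + s)) a) (far-next s h a ha e))
    inv : ∀ s → s ≤ k → OffLegs₀₁ (r s)
    inv zero _ = pre
    inv (suc s) h with inv s (≤-trans (n≤1+n s) h)
    ... | e0' , e1' with 1 ≤? legDepth (fs fz) (r (suc s))
    ...   | yes q = ⊥-elim (1+n≰n (≤-trans (≤-trans (≤-reflexive (+-comm 1 ρ)) (far-now s (≤-trans (n≤1+n s) h) (k + 0) (k+s<n 0 z≤n) (enters-leg-from-hub (fs fz) (w s h) e1' q))) (≤-trans (cdist≤∣-∣ (k + s) (k + 0)) (≤-trans (≤-reflexive (trans (∣m+n-m+o∣≡∣n-o∣ k s 0) (∣-∣-identityʳ s))) (≤-trans (≤-trans (n≤1+n s) h) k≤ρ)))))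
    ...   | no q1 with 1 ≤? legDepth fz (r (suc s))
    ...     | yes q = ⊥-elim (off-cycle s h 0 (s≤s z≤n) (enters-leg-from-hub fz (w s h) e0' q))
    ...     | no q0 = n<1⇒n≡0 (≰⇒> q0) , n<1⇒n≡0 (≰⇒> q1)
    deep-on-leg₂ : ∀ j → r k ≡ inj₂ (fs (fs fz) , j) → ρ + 1 ≤ legDepth (fs (fs fz)) (r k)
    deep-on-leg₂ j e with (ρ + 1) ≤? suc (toℕ j)
    ... | yes q = subst (λ z → ρ + 1 ≤ legDepth (fs (fs fz)) z) (sym e) q
    ... | no q = ⊥-elim (near-on-leg (fs (fs fz)) 0 (suc (toℕ j)) z≤n (toℕ<n j) (≤-pred (subst (suc (suc (toℕ j)) ≤_) (+-comm ρ 1) (≰⇒> q))) (subst (Far (leg (fs (fs fz)) 0)) (trans e (inj₂≡leg _ j)) (subst (λ z → Far z (r k)) arc₁₂-ends-at-hub₂ (f1 k ≤-refl))))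
    fin : ρ + 1 ≤ legDepth (fs (fs fz)) (r k)
    fin with r k' in ek
    ... | inj₁ a = ⊥-elim (off-cycle k' ≤-refl (toℕ a) (toℕ<n a) (trans ek (sym (cycV-toℕ a))))
    ... | inj₂ (fz , j) = ⊥-elim (1+n≢0 (trans (sym (cong (legDepth fz) ek)) (proj₁ (inv k' (n≤1+n k')))))
    ... | inj₂ (fs fz , j) = ⊥-elim (1+n≢0 (trans (sym (cong (legDepth (fs fz)) ek)) (proj₂ (inv k' (n≤1+n k')))))
    ... | inj₂ (fs (fs fz) , j) with leg-moves (fs (fs fz)) j (r k) (subst (λ z → Stp z (r k)) ek (w k' ≤-refl))
    ...   | inj₂ (inj₂ (inj₂ (e , _))) = ⊥-elim (subst (Far (cycV (k + k))) e (f1 k ≤-refl) (subst (Reach G ρ (cycV (k + k))) arc₁₂-ends-at-hub₂ (Reach-mono z≤n here)))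
    ...   | inj₁ e = deep-on-leg₂ j e
    ...   | inj₂ (inj₁ (j' , e , _)) = deep-on-leg₂ j' e
    ...   | inj₂ (inj₂ (inj₁ (j' , e , _))) = deep-on-leg₂ j' e

  climb₂-catches : ∀ r → Escapes G ρ d climb₂ r → ρ + 1 ≤ legDepth (fs (fs fz)) (r 0) → ⊥
  climb₂-catches r (w , f1 , f2) pre = beyond-leg-end _ (inv d ≤-refl) (legDepth≤l (fs (fs fz)) (r d))
    where
    inv : ∀ s → s ≤ d → ρ + 1 + s ≤ legDepth (fs (fs fz)) (r s)
    inv zero _ = subst (_≤ legDepth (fs (fs fz)) (r 0)) (sym (+-identityʳ (ρ + 1))) pre
    inv (suc s) h = push-along-leg (fs (fs fz)) s (≤-trans h d≤ρ) (≤-trans h d≤l) (inv s (≤-trans (n≤1+n s) h)) (w s h) (f1 (suc s) h)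

  descend₀-walk : IsWalk G d descend₀
  descend₀-walk t h = subst (λ z → Stp (leg fz z) (leg fz (d ∸ suc t))) (sym (∸-sucʳ d t h)) (Step-sym (leg-step fz (d ∸ suc t) (≤-trans (subst (_≤ d) (∸-sucʳ d t h) (m∸n≤m d t)) d≤l)))
  arc₀₁-walk : IsWalk G k arc₀₁
  arc₀₁-walk t h = cycV-step t (≤-<-trans h k<n)
  climb₁-walk : IsWalk G d climb₁
  climb₁-walk t h = leg-step (fs fz) t (≤-trans h d≤l)
  descend₁-walk : IsWalk G d descend₁
  descend₁-walk t h = subst (λ z → Stp (leg (fs fz) z) (leg (fs fz) (d ∸ suc t))) (sym (∸-sucʳ d t h)) (Step-sym (leg-step (fs fz) (d ∸ suc t) (≤-trans (subst (_≤ d) (∸-sucʳ d t h) (m∸n≤m d t)) d≤l)))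
  arc₁₂-walk : IsWalk G k arc₁₂
  arc₁₂-walk t h = subst (λ z → Stp (cycV (k + t)) (cycV z)) (sym (+-suc k t)) (cycV-step (k + t) (subst (_< n) (+-suc k t) (k+s<n (suc t) h)))
  climb₂-walk : IsWalk G d climb₂
  climb₂-walk t h = leg-step (fs (fs fz)) t (≤-trans h d≤l)

  from-arc₁₂ from-descend₁ from-climb₁ from-arc₀₁ patrol : ℕ → V
  from-arc₁₂ = append k arc₁₂ climb₂
  from-descend₁ = append d descend₁ from-arc₁₂
  from-climb₁ = append d climb₁ from-descend₁
  from-arc₀₁ = append k arc₀₁ from-climb₁
  patrol = append d descend₀ from-arc₀₁

  arc₁₂-joins : arc₁₂ k ≡ climb₂ 0
  arc₁₂-joins = arc₁₂-ends-at-hub₂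
  descend₁-joins : descend₁ d ≡ from-arc₁₂ 0
  descend₁-joins = trans (cong (leg (fs fz)) (n∸n≡0 d)) (sym (append-left k arc₁₂ climb₂ 0 z≤n))
  climb₁-joins : climb₁ d ≡ from-descend₁ 0
  climb₁-joins = sym (append-left d descend₁ from-arc₁₂ 0 z≤n)
  arc₀₁-joins : arc₀₁ k ≡ from-climb₁ 0
  arc₀₁-joins = trans (cong cycV (sym (+-identityʳ k))) (sym (append-left d climb₁ from-descend₁ 0 z≤n))
  descend₀-joins : descend₀ d ≡ from-arc₀₁ 0
  descend₀-joins = trans (cong (leg fz) (n∸n≡0 d)) (sym (append-left k arc₀₁ from-climb₁ 0 z≤n))

  patrol-walk : IsWalk G (d + (k + (d + (d + (k + d))))) patrol
  patrol-walk =
    append-walk _ _ _ _ descend₀-walk (append-walk _ _ _ _ arc₀₁-walk (append-walk _ _ _ _ climb₁-walk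
      (append-walk _ _ _ _ descend₁-walk (append-walk _ _ _ _ arc₁₂-walk climb₂-walk arc₁₂-joins) descend₁-joins) climb₁-joins) arc₀₁-joins) descend₀-joins

  at+0 : ∀ {P : V → Set} (r : ℕ → V) L → P (r L) → P (r (L + 0))
  at+0 {P} r L x = subst (λ z → P (r z)) (sym (+-identityʳ L)) x

  catches : ∀ r → Escapes G ρ (d + (k + (d + (d + (k + d))))) patrol r → ⊥
  catches r esc with append-escapes d _ descend₀ _ r descend₀-joins esc
  ... | eA , esc1 with append-escapes k _ arc₀₁ _ _ arc₀₁-joins esc1
  ... | eB , esc2 with append-escapes d _ climb₁ _ _ climb₁-joins esc2
  ... | eC1 , esc3 with append-escapes d _ descend₁ _ _ descend₁-joins esc3
  ... | eC2 , esc4 with append-escapes k _ arc₁₂ _ _ arc₁₂-joins esc4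
  ... | eD , eE =
    climb₂-catches _ eE (at+0 {λ u → ρ + 1 ≤ legDepth (fs (fs fz)) u} r₄ k
     (arc₁₂-into-leg₂ _ eD (at+0 {OffLegs₀₁} r₃ d
      (descend₁-keeps-off-legs₀₁ _ eC2 (at+0 {OffLegs₀₁AndFar} r₂ d
       (climb₁-clears-leg₁ _ eC1 (at+0 {InLeg₁or₂} r₁ k
        (arc₀₁-into-legs₁₂ _ eB (at+0 {λ u → legDepth fz u ≡ 0} r d (descend₀-off-leg₀ r eA d ≤-refl))))))))))
    where
    r₁ r₂ r₃ r₄ : ℕ → V
    r₁ = later d r
    r₂ = later k r₁
    r₃ = later d r₂
    r₄ = later d r₃

  patrol-wins : CopWins G ρ
  patrol-wins = _ , patrol , patrol-walk , catches

n≤2*⌈n/2⌉ : ∀ n → n ≤ 2 * ⌈ n /2⌉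
n≤2*⌈n/2⌉ n = begin
  n                     ≡⟨ sym (⌊n/2⌋+⌈n/2⌉≡n n) ⟩
  ⌊ n /2⌋ + ⌈ n /2⌉     ≤⟨ +-monoˡ-≤ ⌈ n /2⌉ (⌊n/2⌋≤⌈n/2⌉ n) ⟩
  ⌈ n /2⌉ + ⌈ n /2⌉     ≡⟨ cong (⌈ n /2⌉ +_) (sym (+-identityʳ ⌈ n /2⌉)) ⟩
  2 * ⌈ n /2⌉           ∎
  where open ≤-Reasoning

⌈/2⌉≤⇔ : ∀ n m → ⌈ n /2⌉ ≤ m ⇔ n ≤ 2 * m
⌈/2⌉≤⇔ n m = mk⇔ (λ h → ≤-trans (n≤2*⌈n/2⌉ n) (*-monoʳ-≤ 2 h))
                 (λ h → ≤-trans (⌈n/2⌉-mono h) (≤-reflexive (sym (trans (n≡⌈n+n/2⌉ m) (cong (λ x → ⌈ m + x /2⌉) (sym (+-identityʳ m)))))))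

n≤4*⌈n/4⌉ : ∀ n → n ≤ 4 * ⌈ n /4⌉
n≤4*⌈n/4⌉ n = +-cancelʳ-≤ 3 n (4 * q) (begin
  n + 3                 ≡⟨ m≡m%n+[m/n]*n (n + 3) 4 ⟩
  (n + 3) % 4 + q * 4   ≤⟨ +-monoˡ-≤ (q * 4) (≤-pred (m%n<n (n + 3) 4)) ⟩
  3 + q * 4             ≡⟨ cong (3 +_) (*-comm q 4) ⟩
  3 + 4 * q             ≡⟨ +-comm 3 (4 * q) ⟩
  4 * q + 3             ∎)
  where
  open ≤-Reasoning
  q = ⌈ n /4⌉

⌈/4⌉≤⇔ : ∀ n m → ⌈ n /4⌉ ≤ m ⇔ n ≤ 4 * m
⌈/4⌉≤⇔ n m = mk⇔ (λ h → ≤-trans (n≤4*⌈n/4⌉ n) (*-monoʳ-≤ 4 h))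
                 (λ h → ≤-pred (m<n*o⇒m/o<n (s≤s (≤-trans (+-monoˡ-≤ 3 h) (≤-reflexive (4m+3≡ m))))))
  where
  4m+3≡ : ∀ m → 4 * m + 3 ≡ 3 + m * 4
  4m+3≡ m = solve (m ∷ [])

∸2≤⇔ : ∀ n m → n ∸ 2 ≤ m ⇔ n ≤ m + 2
∸2≤⇔ n m = mk⇔ (λ h → ≤-trans (m≤n+m∸n n 2) (subst (2 + (n ∸ 2) ≤_) (+-comm 2 m) (+-monoʳ-≤ 2 h)))
               (λ h → m≤n+o⇒m∸n≤o n 2 (subst (n ≤_) (+-comm m 2) h))

radius≤⇔ : ∀ k l ρ → ⌈ 2 * l + k ∸ 2 /4⌉ ⊔ ⌈ 3 * k ∸ 2 /2⌉ ≤ ρ ⇔ (2 * l + k ≤ 4 * ρ + 2 × 3 * k ≤ 2 * ρ + 2)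
radius≤⇔ k l ρ = mk⇔
  (λ h → to (∸2≤⇔ _ _) (to (⌈/4⌉≤⇔ _ _) (m⊔n≤o⇒m≤o _ _ h)) , to (∸2≤⇔ _ _) (to (⌈/2⌉≤⇔ _ _) (m⊔n≤o⇒n≤o _ _ h)))
  (λ (legs , cycle) → ⊔-lub (from (⌈/4⌉≤⇔ _ _) (from (∸2≤⇔ _ _) legs)) (from (⌈/2⌉≤⇔ _ _) (from (∸2≤⇔ _ _) cycle)))
  where open Equivalence

theorem5 : (k l : ℕ) → 1 ≤ k → 1 ≤ l →
    PatrolNumberIs (T k l) (⌈ 2 * l + k ∸ 2 /4⌉ ⊔ ⌈ 3 * k ∸ 2 /2⌉)
theorem5 k@(suc k') l@(suc l') (s≤s z≤n) (s≤s z≤n) = Patrol.patrol-wins k' l' m short-cycle short-legs , minimal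
  where
  m = ⌈ 2 * l + k ∸ 2 /4⌉ ⊔ ⌈ 3 * k ∸ 2 /2⌉
  short-legs = proj₁ (Equivalence.to (radius≤⇔ k l m) ≤-refl)
  short-cycle = proj₂ (Equivalence.to (radius≤⇔ k l m) ≤-refl)
  minimal : ∀ ρ → CopWins (T k l) ρ → m ≤ ρ
  minimal ρ cop-wins with 3 * k ≤? 2 * ρ + 2 | 2 * l + k ≤? 4 * ρ + 2
  ... | no long-cycle | _ = ⊥-elim (CycleStrategy.¬copWins k' l' ρ (≰⇒> long-cycle) cop-wins)
  ... | yes short-cycle | no long-legs = ⊥-elim (LegStrategy.¬copWins k' l' ρ short-cycle (≰⇒> long-legs) cop-wins)
  ... | yes short-cycle | yes short-legs = Equivalence.from (radius≤⇔ k l ρ) (short-legs , short-cycle)
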